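{- Let $\mathbb{K}$ be a commutative ring with $1$ and $x\in\mathbb{K}$. Any character $\chi$ of $\mathsf{M}_k(x)$ (the trace function of an $\mathsf{M}_k(x)$-module that is free of finite rank over $\mathbb{K}$) is completely determined by its values on the diagrams $\mathbf{1}_{\ell,k}$, $0\le\ell\le k$.
   Context: A Motzkin $k$-diagram is a graph on top vertices $1,\dots,k$ and bottom vertices $1',\dots,k'$ with each vertex incident to at most one edge and edges non-crossing inside the rectangle. $\mathsf{M}_k(x)$ is the free $\mathbb{K}$-module with basis the Motzkin $k$-diagrams and product $d_1d_2=x^\kappa d_3$: stack $d_1$ above $d_2$ identifying bottom vertex $j'$ of $d_1$ with top vertex $j$ of $d_2$; $d_3$ joins two outer vertices iff a path in the stack joins them; $\kappa$ is the number of closed loops in the middle row. $\mathbf{1}_{\ell,k}$ is the diagram with edges $j$–$j'$ for $1\le j\le\ell$ and all other vertices isolated. -}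

module Defs where

open import Level using (Level)
open import Data.Nat as ℕ using (ℕ; zero; suc; _∸_; _≤ᵇ_; _<ᵇ_)
open import Data.Fin as Fin using (Fin; toℕ; splitAt; _↑ˡ_; _↑ʳ_)
open import Data.Sum using (_⊎_; inj₁; inj₂)
open import Data.Maybe using (Maybe; just; nothing; _>>=_)
open import Data.Bool using (Bool; true; false; _∧_; _∨_; not; if_then_else_; T)
open import Data.Vec using (Vec; lookup; tabulate)
open import Data.List using (List; []; _∷_; allFin; upTo; length; filter)

allB anyB : {A : Set} → (A → Bool) → List A → Bool
allB p []       = true
allB p (a ∷ as) = p a ∧ allB p as
anyB p []       = false
anyB p (a ∷ as) = p a ∨ anyB p as

infixl 6 _+_
_+_ : ℕ → ℕ → ℕ
_+_ = ℕ._+_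
open import Relation.Nullary.Decidable using (⌊_⌋; does)
open import Algebra.Bundles using (CommutativeRing)
open import Relation.Binary.PropositionalEquality using (_≡_)
open import Relation.Nullary.Decidable using (T?)

-- Index  i ↑ˡ k  (i : Fin k) is the top vertex
-- i+1, index  k ↑ʳ j  is the bottom vertex (j+1)'.  A (raw) diagram lists,
-- for every vertex, its partner (or nothing if isolated).

Vertex : ℕ → Set
Vertex k = Fin (k + k)

top : ∀ {k} → Fin k → Vertex k
top {k} i = i ↑ˡ k

bot : ∀ {k} → Fin k → Vertex k
bot {k} j = k ↑ʳ j

record Raw (k : ℕ) : Set where
  constructor raw
  field
    table : Vec (Maybe (Vertex k)) (k + k)
open Raw public

partner : ∀ {k} → Raw k → Vertex k → Maybe (Vertex k)
partner d v = lookup (table d) v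

eqF : ∀ {n} → Fin n → Fin n → Bool
eqF a b = ⌊ a Fin.≟ b ⌋

eqMF : ∀ {n} → Maybe (Fin n) → Maybe (Fin n) → Bool
eqMF nothing  nothing  = true
eqMF (just a) (just b) = eqF a b
eqMF _        _        = false

-- position of a vertex on the boundary of the rectangle, read
-- clockwise: top 1..k left to right, then bottom k'..1' right to left
pos : ∀ {k} → Vertex k → ℕ
pos {k} v with splitAt k v
... | inj₁ i = toℕ i
... | inj₂ j = (k + k) ∸ 1 ∸ toℕ j

minℕ maxℕ : ℕ → ℕ → ℕ
minℕ p q = if p ≤ᵇ q then p else q
maxℕ p q = if p ≤ᵇ q then q else p

-- chords {p,q} and {r,s} of the boundary circle cross
crosses : ℕ → ℕ → ℕ → ℕ → Bool
crosses p q r s =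
  let a = minℕ p q ; b = maxℕ p q ; c = minℕ r s ; e = maxℕ r s in
  ((a <ᵇ c) ∧ (c <ᵇ b) ∧ (b <ᵇ e)) ∨ ((c <ᵇ a) ∧ (a <ᵇ e) ∧ (e <ᵇ b))

involutive : ∀ {k} → Raw k → Bool
involutive {k} d = allB (λ a → ok a (partner d a)) (allFin (k + k))
  where
  ok : Vertex k → Maybe (Vertex k) → Bool
  ok a nothing  = true
  ok a (just b) = not (eqF a b) ∧ eqMF (partner d b) (just a)

nonCrossing : ∀ {k} → Raw k → Bool
nonCrossing {k} d = allB (λ a → allB (λ c → nc a c (partner d a) (partner d c)) (allFin (k + k))) (allFin (k + k))
  where
  nc : Vertex k → Vertex k → Maybe (Vertex k) → Maybe (Vertex k) → Bool
  nc a c (just b) (just e) = not (crosses (pos {k} a) (pos {k} b) (pos {k} c) (pos {k} e))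
  nc a c _        _        = true

isMotzkin : ∀ {k} → Raw k → Bool
isMotzkin d = involutive d ∧ nonCrossing d

record Diagram (k : ℕ) : Set where
  constructor diagram
  field
    edges : Raw k
    valid : T (isMotzkin edges)
open Diagram public

-- The diagram 1_{ℓ,k}: edges j — j' for j ≤ ℓ (1-indexed), others isolated.

oneRaw : (ℓ k : ℕ) → Raw k
oneRaw ℓ k = raw (tabulate f)
  where
  f : Vertex k → Maybe (Vertex k)
  f v with splitAt k v
  ... | inj₁ i = if (toℕ i <ᵇ ℓ) then just (bot i) else nothing
  ... | inj₂ j = if (toℕ j <ᵇ ℓ) then just (top j) else nothing

-- Product of diagrams: d₁ stacked above d₂.
-- Middle row vertex j = bottom j of d₁ = top j of d₂.

module Compose {k : ℕ} (d₁ d₂ : Raw k) where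

  -- walk through the stack; fuel bounds the path length (2k+2 suffices)
  -- from1 j : arrive at middle vertex j, continue with the edge of d₁ at bottom j
  -- from2 j : arrive at middle vertex j, continue with the edge of d₂ at top j
  from1 from2 : ℕ → Fin k → Maybe (Vertex k)
  from1 zero    j = nothing
  from1 (suc f) j with partner d₁ (bot j)
  ... | nothing = nothing
  ... | just w with splitAt k w
  ...   | inj₁ i  = just (top i)
  ...   | inj₂ j' = from2 f j'
  from2 zero    j = nothing
  from2 (suc f) j with partner d₂ (top j)
  ... | nothing = nothing
  ... | just w with splitAt k w
  ...   | inj₁ j' = from1 f j'
  ...   | inj₂ i  = just (bot i)

  fuel : ℕ
  fuel = suc (suc (k + k))

  outPartner : Vertex k → Maybe (Vertex k)
  outPartner v with splitAt k v
  ... | inj₁ i with partner d₁ (top i)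
  ...   | nothing = nothing
  ...   | just w with splitAt k w
  ...     | inj₁ i' = just (top i')
  ...     | inj₂ j  = from2 fuel j
  outPartner v | inj₂ i with partner d₂ (bot i)
  ...   | nothing = nothing
  ...   | just w with splitAt k w
  ...     | inj₁ j  = from1 fuel j
  ...     | inj₂ i' = just (bot i')

  result : Raw k
  result = raw (tabulate outPartner)

  -- closed loops in the middle row
  -- p₁ j : the middle vertex joined to j by a bottom–bottom edge of d₁
  -- p₂ j : the middle vertex joined to j by a top–top edge of d₂
  p₁ p₂ g : Fin k → Maybe (Fin k)
  p₁ j with partner d₁ (bot j)
  ... | nothing = nothing
  ... | just w with splitAt k w
  ...   | inj₁ _ = nothing
  ...   | inj₂ j' = just j'
  p₂ j with partner d₂ (top j)
  ... | nothing = nothing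
  ... | just w with splitAt k w
  ...   | inj₁ j' = just j'
  ...   | inj₂ _ = nothing
  g j = p₁ j >>= p₂

  giter : ℕ → Fin k → Maybe (Fin k)
  giter zero    j = just j
  giter (suc n) j = giter n j >>= g

  onLoop : Fin k → Bool
  onLoop j = anyB (λ n → eqMF (giter (suc n) j) (just j)) (upTo k)

  leOpt : Fin k → Maybe (Fin k) → Bool
  leOpt j nothing  = true
  leOpt j (just u) = (toℕ j ≤ᵇ toℕ u)

  isMinOfLoop : Fin k → Bool
  isMinOfLoop j = allB (λ t → okAt (giter t j)) (upTo (suc k))
    where
    okAt : Maybe (Fin k) → Bool
    okAt nothing  = true
    okAt (just u) = leOpt j (just u) ∧ leOpt j (p₁ u)

  loops : ℕ
  loops = length (filter (λ j → T? (onLoop j ∧ isMinOfLoop j)) (allFin k))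

compose : ∀ {k} → Raw k → Raw k → Raw k
compose d₁ d₂ = Compose.result d₁ d₂

loopCount : ∀ {k} → Raw k → Raw k → ℕ
loopCount d₁ d₂ = Compose.loops d₁ d₂

module Matrices {c ℓ : Level} (K : CommutativeRing c ℓ) where
  open CommutativeRing K hiding (_+_)
  open CommutativeRing K using () renaming (_+_ to _⊕_)

  Mat : ℕ → Set c
  Mat n = Fin n → Fin n → Carrier

  sumFin : ∀ {n} → (Fin n → Carrier) → Carrier
  sumFin {zero}  f = 0#
  sumFin {suc n} f = f Fin.zero ⊕ sumFin (λ i → f (Fin.suc i))

  _⊗_ : ∀ {n} → Mat n → Mat n → Mat n
  (A ⊗ B) i j = sumFin (λ t → A i t * B t j)

  _·_ : ∀ {n} → Carrier → Mat n → Mat n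
  (a · A) i j = a * A i j

  I : ∀ {n} → Mat n
  I i j = if eqF i j then 1# else 0#

  _≈M_ : ∀ {n} → Mat n → Mat n → Set ℓ
  A ≈M B = ∀ i j → A i j ≈ B i j

  trace : ∀ {n} → Mat n → Carrier
  trace A = sumFin (λ i → A i i)

  pow : Carrier → ℕ → Carrier
  pow a zero    = 1#
  pow a (suc m) = a * pow a m

  -- A representation of M_k(x) on the free module K^n (a unital algebra
  -- homomorphism M_k(x) → Mat_n(K), given on the diagram basis).
  record IsRep (x : Carrier) (k n : ℕ) (ρ : Diagram k → Mat n) : Set (c Level.⊔ ℓ) where
    field
      unital : ∀ (d : Diagram k) → edges d ≡ oneRaw k k → ρ d ≈M I
      mult   : ∀ (d₁ d₂ d₃ : Diagram k) → edges d₃ ≡ compose (edges d₁) (edges d₂) →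
               (ρ d₁ ⊗ ρ d₂) ≈M (pow x (loopCount (edges d₁) (edges d₂)) · ρ d₃)

-- Since tr(ρ(A) ρ(B)) = tr(ρ(B) ρ(A)), two characters agree on d = A B (no closed loop) as soon as they agree on
-- B A = x^κ d′. We induct on the number of non-isolated vertices of d. If a top vertex c is isolated while c′
-- is not, d = 1∖c · d while d · 1∖c deletes the edge at c′ (and symmetrically). Otherwise an innermost cap
-- p–q factors d = E B, with E the cap–cup diagram on [p, q] and B = d minus the cap, and B E has one edge
-- fewer; likewise for cups. What remains are partial identities, and conjugating by a pair of slant diagrams
-- moves their strands one step to the left until they form some 1_{ℓ,k}.

module Submission where

open import Defs
open import Level using (Level)
open import Data.Nat as ℕ using (ℕ; zero; suc; _∸_; _≤ᵇ_; _<ᵇ_; _<_; _≤_; z≤n; s≤s)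
open import Data.Nat.Properties
  using (<ᵇ⇒<; <⇒<ᵇ; ≤ᵇ⇒≤; ≤⇒≤ᵇ; <-cmp; m+n∸m≡n; ∸-monoʳ-≤; ∸-+-assoc; m∸n≤m; ∸-monoʳ-<; ∸-cancelˡ-≡; <-trans; <-irrefl; <-asym; <⇒≤; <⇒≱; ≤-refl; ≤-trans; ≤-pred;
         <-≤-trans; ≤-<-trans; n<1+n; n≤1+n; +-suc; +-assoc; +-cancelʳ-≡; ≤-reflexive; m<n⇒0<n∸m; +-mono-≤; +-mono-≤-<)
open import Data.Fin as Fin using (Fin; toℕ; splitAt)
open import Data.Fin.Properties using (suc-injective; toℕ<n; splitAt-↑ˡ; splitAt-↑ʳ; join-splitAt; ↑ˡ-injective; ↑ʳ-injective; toℕ-injective)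
open import Data.Maybe using (Maybe; just; nothing; is-just)
open import Data.Maybe.Properties using (just-injective)
open import Data.Bool using (Bool; true; false; _∧_; _∨_; not; _xor_; if_then_else_; T)
open import Data.Bool.Properties using (xor-same; xor-comm; ∨-comm; ∧-comm; ∧-zeroʳ; ∧-identityʳ)
open import Data.Product using (Σ; ∃; _×_; _,_; proj₁; proj₂)
open import Data.Sum using (_⊎_; inj₁; inj₂; [_,_])
open import Data.Empty using (⊥; ⊥-elim)
open import Data.Unit using (tt)
open import Data.List using ([]; _∷_; allFin; length; filter)
import Data.List as List
open import Data.Vec using (Vec; lookup; tabulate)
open import Data.Vec.Properties using (lookup∘tabulate; tabulate-cong; tabulate∘lookup)
open import Algebra.Bundles using (CommutativeRing)
open import Relation.Nullary using (yes; no)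
open import Relation.Nullary.Decidable using (T?)
open import Relation.Binary.Definitions using (tri<; tri≈; tri>)
open import Relation.Binary.PropositionalEquality using (_≡_; _≢_; refl; sym; trans; cong; cong₂; subst; ≢-sym; module ≡-Reasoning)
import Data.Nat.Solver

∧-split : ∀ {a b} → a ∧ b ≡ true → a ≡ true × b ≡ true
∧-split {true} {true} _ = refl , refl

∧-pair : ∀ {a b} → a ≡ true → b ≡ true → a ∧ b ≡ true
∧-pair refl refl = refl

not-true : ∀ {a} → not a ≡ true → a ≡ false
not-true {false} _ = refl

xor≡false⇒≡ : ∀ {a b} → (a xor b) ≡ false → a ≡ b
xor≡false⇒≡ {true}  {true}  _ = refl
xor≡false⇒≡ {false} {false} _ = refl

T⇒≡true : ∀ {b} → T b → b ≡ true
T⇒≡true {true} _ = refl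

≡true⇒T : ∀ {b} → b ≡ true → T b
≡true⇒T refl = tt

<ᵇ-true : ∀ {m n} → m < n → (m <ᵇ n) ≡ true
<ᵇ-true m<n = T⇒≡true (<⇒<ᵇ m<n)

<ᵇ-false : ∀ {m n} → n ≤ m → (m <ᵇ n) ≡ false
<ᵇ-false {m} {n} n≤m with m <ᵇ n in eq
... | false = refl
... | true  = ⊥-elim (<⇒≱ (<ᵇ⇒< m n (≡true⇒T eq)) n≤m)

≡true⇒< : ∀ {m n} → (m <ᵇ n) ≡ true → m < n
≡true⇒< {m} {n} h = <ᵇ⇒< m n (≡true⇒T h)

≤ᵇ-true : ∀ {m n} → m ≤ n → (m ≤ᵇ n) ≡ true
≤ᵇ-true m≤n = T⇒≡true (≤⇒≤ᵇ m≤n)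

≤ᵇ-false : ∀ {m n} → n < m → (m ≤ᵇ n) ≡ false
≤ᵇ-false {m} {n} n<m with m ≤ᵇ n in eq
... | false = refl
... | true  = ⊥-elim (<⇒≱ n<m (≤ᵇ⇒≤ m n (≡true⇒T eq)))

<ᵇ-irrefl : ∀ n → (n <ᵇ n) ≡ false
<ᵇ-irrefl n = <ᵇ-false {n} ≤-refl

eqF-refl : ∀ {n} (a : Fin n) → eqF a a ≡ true
eqF-refl a with a Fin.≟ a
... | yes _ = refl
... | no a≢a = ⊥-elim (a≢a refl)

eqF-≢ : ∀ {n} {a b : Fin n} → a ≢ b → eqF a b ≡ false
eqF-≢ {a = a} {b} a≢b with a Fin.≟ b
... | yes a≡b = ⊥-elim (a≢b a≡b)
... | no _    = refl

eqF⇒≡ : ∀ {n} {a b : Fin n} → eqF a b ≡ true → a ≡ b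
eqF⇒≡ {a = a} {b} h with a Fin.≟ b
... | yes a≡b = a≡b

not-eqF⇒≢ : ∀ {n} {a b : Fin n} → not (eqF a b) ≡ true → a ≢ b
not-eqF⇒≢ {a = a} h refl with trans (sym (cong not (eqF-refl a))) h
... | ()

eqMF⇒≡ : ∀ {n} {m : Maybe (Fin n)} {a} → eqMF m (just a) ≡ true → m ≡ just a
eqMF⇒≡ {m = just _} h = cong just (eqF⇒≡ h)

≡⇒eqMF : ∀ {n} {m : Maybe (Fin n)} {a} → m ≡ just a → eqMF m (just a) ≡ true
≡⇒eqMF {a = a} refl = eqF-refl a

nothing≢just : ∀ {A : Set} {a : A} → nothing ≢ just a
nothing≢just ()

true≢false : true ≢ false
true≢false ()

toℕ-<⇒≢ : ∀ {n} {i j : Fin n} → toℕ i < toℕ j → i ≢ j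
toℕ-<⇒≢ i<j refl = <-irrefl refl i<j

strictly-between-≢ : ∀ {n} {p q j : Fin n} → (toℕ p <ᵇ toℕ j) ≡ true → (toℕ j <ᵇ toℕ q) ≡ true → j ≢ p × j ≢ q
strictly-between-≢ p<j j<q = ≢-sym (toℕ-<⇒≢ (≡true⇒< p<j)) , toℕ-<⇒≢ (≡true⇒< j<q)

allB-elim : ∀ {A : Set} {n} {p : A → Bool} (f : Fin n → A) → allB p (List.tabulate f) ≡ true → ∀ i → p (f i) ≡ true
allB-elim {n = suc n} f h Fin.zero    = proj₁ (∧-split h)
allB-elim {n = suc n} f h (Fin.suc i) = allB-elim (λ j → f (Fin.suc j)) (proj₂ (∧-split h)) i

allB-witness : ∀ {A : Set} {p : A → Bool} xs → allB p xs ≡ false → ∃ λ a → p a ≡ false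
allB-witness {p = p} (a ∷ as) h with p a in pa
... | false = a , pa
... | true  = allB-witness as h

anyB-false : ∀ {A : Set} {p : A → Bool} → (∀ a → p a ≡ false) → ∀ xs → anyB p xs ≡ false
anyB-false h []       = refl
anyB-false h (a ∷ as) rewrite h a = anyB-false h as

searchFin : ∀ {n} (f : Fin n → Bool) → (∃ λ c → f c ≡ true) ⊎ (∀ c → f c ≡ false)
searchFin {zero} f = inj₂ (λ ())
searchFin {suc n} f with f Fin.zero in f0
... | true = inj₁ (Fin.zero , f0)
... | false with searchFin (λ i → f (Fin.suc i))
...   | inj₁ (c , fc) = inj₁ (Fin.suc c , fc)
...   | inj₂ none     = inj₂ λ { Fin.zero → f0 ; (Fin.suc c) → none c }

boolToℕ : Bool → ℕ
boolToℕ true  = 1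
boolToℕ false = 0

count : ∀ {n} → (Fin n → Bool) → ℕ
count {zero}  f = 0
count {suc n} f = boolToℕ (f Fin.zero) ℕ.+ count (λ i → f (Fin.suc i))

boolToℕ-mono : ∀ {a b} → (a ≡ true → b ≡ true) → boolToℕ a ≤ boolToℕ b
boolToℕ-mono {false} h = z≤n
boolToℕ-mono {true}  h rewrite h refl = ≤-refl

count-mono : ∀ {n} {f g : Fin n → Bool} → (∀ v → f v ≡ true → g v ≡ true) → count f ≤ count g
count-mono {zero}  h = z≤n
count-mono {suc n} h = +-mono-≤ (boolToℕ-mono (h Fin.zero)) (count-mono (λ v → h (Fin.suc v)))

count-mono-< : ∀ {n} {f g : Fin n → Bool} → (∀ v → f v ≡ true → g v ≡ true) →
               ∀ w → f w ≡ false → g w ≡ true → count f < count g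
count-mono-< {suc n} h Fin.zero    fw gw rewrite fw | gw = s≤s (count-mono (λ v → h (Fin.suc v)))
count-mono-< {suc n} h (Fin.suc w) fw gw =
  +-mono-≤-< (boolToℕ-mono (h Fin.zero)) (count-mono-< (λ v → h (Fin.suc v)) w fw gw)

IsThreshold : ∀ {k} → (Fin k → Bool) → ℕ → Set
IsThreshold S m = ∀ i → S i ≡ (toℕ i <ᵇ m)

threshold-or-gap : ∀ {k} (S : Fin k → Bool) →
  (∃ λ m → m ≤ k × IsThreshold S m) ⊎ (∃ λ a → ∃ λ b → toℕ b ≡ suc (toℕ a) × S a ≡ false × S b ≡ true)
threshold-or-gap {zero} S = inj₁ (0 , z≤n , λ ())
threshold-or-gap {suc k} S with threshold-or-gap (λ i → S (Fin.suc i))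
... | inj₂ (a , b , b≡a+1 , sa , sb) = inj₂ (Fin.suc a , Fin.suc b , cong suc b≡a+1 , sa , sb)
... | inj₁ (m , m≤k , thr) with S Fin.zero in s0
...   | true = inj₁ (suc m , s≤s m≤k , λ { Fin.zero → s0 ; (Fin.suc i) → thr i })
...   | false with m | m≤k
...     | zero  | _     = inj₁ (0 , z≤n , λ { Fin.zero → s0 ; (Fin.suc i) → thr i })
...     | suc _ | s≤s _ = inj₂ (Fin.zero , Fin.suc Fin.zero , refl , s0 , thr Fin.zero)

successor-above : ∀ {k} (a b j : Fin k) → toℕ b ≡ suc (toℕ a) → j ≢ b → j ≢ a → (toℕ b <ᵇ toℕ j) ≡ (toℕ a <ᵇ toℕ j)
successor-above a b j b≡a+1 j≢b j≢a with <-cmp (toℕ j) (toℕ a)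
... | tri< j<a _ _ rewrite <ᵇ-false {toℕ a} {toℕ j} (<⇒≤ j<a) | b≡a+1 = <ᵇ-false (≤-trans (<⇒≤ j<a) (n≤1+n _))
... | tri≈ _ j≡a _ = ⊥-elim (j≢a (toℕ-injective j≡a))
... | tri> _ _ a<j rewrite <ᵇ-true a<j | b≡a+1 with <-cmp (toℕ j) (suc (toℕ a))
...   | tri< j<a+1 _ _ = ⊥-elim (<⇒≱ a<j (≤-pred j<a+1))
...   | tri≈ _ j≡a+1 _ = ⊥-elim (j≢b (toℕ-injective (trans j≡a+1 (sym b≡a+1))))
...   | tri> _ _ a+1<j = <ᵇ-true a+1<j

successor-below : ∀ {k} (a b j : Fin k) → toℕ b ≡ suc (toℕ a) → j ≢ b → j ≢ a → (toℕ j <ᵇ toℕ b) ≡ (toℕ j <ᵇ toℕ a)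
successor-below a b j b≡a+1 j≢b j≢a with <-cmp (toℕ j) (toℕ a)
... | tri< j<a _ _ rewrite <ᵇ-true j<a | b≡a+1 = <ᵇ-true (<-trans j<a (n<1+n _))
... | tri≈ _ j≡a _ = ⊥-elim (j≢a (toℕ-injective j≡a))
... | tri> _ _ a<j rewrite <ᵇ-false {toℕ j} {toℕ a} (<⇒≤ a<j) | b≡a+1 with <-cmp (toℕ j) (suc (toℕ a))
...   | tri< j<a+1 _ _ = ⊥-elim (<⇒≱ a<j (≤-pred j<a+1))
...   | tri≈ _ j≡a+1 _ = ⊥-elim (j≢b (toℕ-injective (trans j≡a+1 (sym b≡a+1))))
...   | tri> _ _ a+1<j = <ᵇ-false (<⇒≤ a+1<j)

sumℕ : ∀ {n} → (Fin n → ℕ) → ℕ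
sumℕ {zero}  f = 0
sumℕ {suc n} f = f Fin.zero ℕ.+ sumℕ (λ i → f (Fin.suc i))

sumℕ-cong : ∀ {n} {f g : Fin n → ℕ} → (∀ i → f i ≡ g i) → sumℕ f ≡ sumℕ g
sumℕ-cong {zero}  h = refl
sumℕ-cong {suc n} h = cong₂ ℕ._+_ (h Fin.zero) (sumℕ-cong (λ i → h (Fin.suc i)))

sumℕ-update : ∀ {n} (f g : Fin n → ℕ) c → (∀ j → j ≢ c → g j ≡ f j) → sumℕ g ℕ.+ f c ≡ sumℕ f ℕ.+ g c
sumℕ-update {suc n} f g Fin.zero h
  rewrite sumℕ-cong {f = λ i → g (Fin.suc i)} {g = λ i → f (Fin.suc i)} (λ i → h (Fin.suc i) (λ ()))
  = solve 3 (λ a b c → (a :+ b) :+ c := (c :+ b) :+ a) refl (g Fin.zero) _ (f Fin.zero)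
  where open Data.Nat.Solver.+-*-Solver
sumℕ-update {suc n} f g (Fin.suc c) h rewrite h Fin.zero (λ ()) =
  trans (+-assoc (f Fin.zero) _ _)
        (trans (cong (f Fin.zero ℕ.+_) (sumℕ-update (λ i → f (Fin.suc i)) (λ i → g (Fin.suc i)) c
                                          (λ j j≢c → h (Fin.suc j) (λ e → j≢c (suc-injective e)))))
               (sym (+-assoc (f Fin.zero) _ _)))

width-shrinks : ∀ a b c e → a < b → e < c → a < c → e ∸ b < c ∸ a
width-shrinks zero    b       c       e       _         e<c       _         = ≤-<-trans (m∸n≤m e b) e<c
width-shrinks (suc a) (suc b) (suc c) zero    _         _         (s≤s a<c) = m<n⇒0<n∸m a<c
width-shrinks (suc a) (suc b) (suc c) (suc e) (s≤s a<b) (s≤s e<c) (s≤s a<c) = width-shrinks a b c e a<b e<c a<c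

weight : ∀ {k} → (Fin k → Bool) → ℕ
weight S = sumℕ (λ j → if S j then toℕ j else 0)

weight-shift : ∀ {k} (S S′ : Fin k → Bool) (a b : Fin k) → toℕ b ≡ suc (toℕ a) → S a ≡ false → S b ≡ true →
               S′ a ≡ true → S′ b ≡ false → (∀ j → j ≢ a → j ≢ b → S′ j ≡ S j) → weight S′ < weight S
weight-shift {k} S S′ a b b≡a+1 sa sb s′a s′b same = ≤-reflexive (+-cancelʳ-≡ (toℕ a) (suc (sumℕ w′)) (sumℕ w) (begin
    suc (sumℕ w′) ℕ.+ toℕ a      ≡⟨ sym (+-suc (sumℕ w′) (toℕ a)) ⟩
    sumℕ w′ ℕ.+ suc (toℕ a)      ≡⟨ cong (sumℕ w′ ℕ.+_) (trans (sym b≡a+1) (sym gb)) ⟩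
    sumℕ w′ ℕ.+ g b              ≡⟨ sumℕ-update g w′ b g-agrees ⟩
    sumℕ g ℕ.+ w′ b              ≡⟨ cong (sumℕ g ℕ.+_) (trans w′b (sym wa)) ⟩
    sumℕ g ℕ.+ w a               ≡⟨ sumℕ-update w g a (λ j j≢a → cong (λ e → if e then toℕ a else w j) (eqF-≢ j≢a)) ⟩
    sumℕ w ℕ.+ g a               ≡⟨ cong (sumℕ w ℕ.+_) ga ⟩
    sumℕ w ℕ.+ toℕ a             ∎))
  where
  open ≡-Reasoning
  w w′ g : Fin k → ℕ
  w j = if S j then toℕ j else 0
  w′ j = if S′ j then toℕ j else 0
  g j = if eqF j a then toℕ a else w j
  a≢b : a ≢ b
  a≢b a≡b = <-irrefl (trans (cong toℕ a≡b) b≡a+1) (n<1+n (toℕ a))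
  ga : g a ≡ toℕ a
  ga rewrite eqF-refl a = refl
  gb : g b ≡ toℕ b
  gb rewrite eqF-≢ (≢-sym a≢b) | sb = refl
  wa : w a ≡ 0
  wa rewrite sa = refl
  w′b : w′ b ≡ 0
  w′b rewrite s′b = refl
  g-agrees : ∀ j → j ≢ b → w′ j ≡ g j
  g-agrees j j≢b with j Fin.≟ a
  ... | yes refl rewrite s′a = refl
  ... | no j≢a rewrite same j j≢a j≢b = refl

top-injective : ∀ {k} {i j : Fin k} → top i ≡ top j → i ≡ j
top-injective {k} = ↑ˡ-injective k _ _

bot-injective : ∀ {k} {i j : Fin k} → bot i ≡ bot j → i ≡ j
bot-injective {k} = ↑ʳ-injective k _ _

top≢bot : ∀ {k} {i j : Fin k} → top i ≢ bot j
top≢bot {k} {i} {j} e with trans (sym (splitAt-↑ˡ k i k)) (trans (cong (splitAt k) e) (splitAt-↑ʳ k k j))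
... | ()

bot≢top : ∀ {k} {i j : Fin k} → bot j ≢ top i
bot≢top e = top≢bot (sym e)

top-≢ : ∀ {k} {i j : Fin k} → i ≢ j → top i ≢ top j
top-≢ i≢j e = i≢j (top-injective e)

bot-≢ : ∀ {k} {i j : Fin k} → i ≢ j → bot i ≢ bot j
bot-≢ i≢j e = i≢j (bot-injective e)

data View {k : ℕ} : Vertex k → Set where
  vtop : (i : Fin k) → View (top i)
  vbot : (j : Fin k) → View (bot j)

view : ∀ {k} (v : Vertex k) → View v
view {k} v with splitAt k v in eq
... | inj₁ i = subst View (trans (sym (cong (Fin.join k k) eq)) (join-splitAt k k v)) (vtop i)
... | inj₂ j = subst View (trans (sym (cong (Fin.join k k) eq)) (join-splitAt k k v)) (vbot j)

data PartnerView {k : ℕ} (m : Maybe (Vertex k)) : Set where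
  isolated : m ≡ nothing → PartnerView m
  toTop    : (i : Fin k) → m ≡ just (top i) → PartnerView m
  toBot    : (j : Fin k) → m ≡ just (bot j) → PartnerView m

partnerView : ∀ {k} (m : Maybe (Vertex k)) → PartnerView {k} m
partnerView nothing = isolated refl
partnerView {k} (just w) with view {k} w
... | vtop i = toTop i refl
... | vbot j = toBot j refl

byRow : ∀ {k} {A : Set} → (Fin k → A) → (Fin k → A) → Vertex k → A
byRow {k} f g v = [ f , g ] (splitAt k v)

byRow-top : ∀ {k} {A : Set} (f g : Fin k → A) i → byRow f g (top i) ≡ f i
byRow-top {k} f g i rewrite splitAt-↑ˡ k i k = refl

byRow-bot : ∀ {k} {A : Set} (f g : Fin k → A) j → byRow f g (bot j) ≡ g j
byRow-bot {k} f g j rewrite splitAt-↑ʳ k k j = refl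

rawByRow : ∀ {k} → (Fin k → Maybe (Vertex k)) → (Fin k → Maybe (Vertex k)) → Raw k
rawByRow f g = raw (tabulate (byRow f g))

partner-rawByRow-top : ∀ {k} f g (i : Fin k) → partner (rawByRow f g) (top i) ≡ f i
partner-rawByRow-top f g i = trans (lookup∘tabulate (byRow f g) (top i)) (byRow-top f g i)

partner-rawByRow-bot : ∀ {k} f g (j : Fin k) → partner (rawByRow f g) (bot j) ≡ g j
partner-rawByRow-bot f g j = trans (lookup∘tabulate (byRow f g) (bot j)) (byRow-bot f g j)

raw-tabulate-cong : ∀ {k} {f g : Vertex k → Maybe (Vertex k)} → (∀ v → f v ≡ g v) → raw (tabulate f) ≡ raw (tabulate g)
raw-tabulate-cong {k} h = cong (raw {k}) (tabulate-cong h)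

raw-tabulate-partner : ∀ {k} {f : Vertex k → Maybe (Vertex k)} (d : Raw k) → (∀ v → f v ≡ partner d v) → raw (tabulate f) ≡ d
raw-tabulate-partner d h = cong raw (trans (tabulate-cong h) (tabulate∘lookup (table d)))

raw-ext : ∀ {k} {d e : Raw k} → (∀ v → partner d v ≡ partner e v) → d ≡ e
raw-ext {d = raw t} {raw u} h = cong raw (trans (sym (tabulate∘lookup t)) (trans (tabulate-cong h) (tabulate∘lookup u)))

lookup-tabulate-of : ∀ {A : Set} {n} {f : Fin n → A} {t : Vec A n} → t ≡ tabulate f → ∀ i → lookup t i ≡ f i
lookup-tabulate-of {f = f} refl = lookup∘tabulate f

-- Defs keeps the partner function of oneRaw local; with-abstraction unfolds it all the same.
partner-oneRaw-top : ∀ ℓ k (i : Fin k) → partner (oneRaw ℓ k) (top i) ≡ (if toℕ i <ᵇ ℓ then just (bot i) else nothing)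
partner-oneRaw-top ℓ k i with splitAt k (top i) | splitAt-↑ˡ k i k | lookup-tabulate-of {t = table (oneRaw ℓ k)} refl (top i)
... | _ | refl | e = e

partner-oneRaw-bot : ∀ ℓ k (j : Fin k) → partner (oneRaw ℓ k) (bot j) ≡ (if toℕ j <ᵇ ℓ then just (top j) else nothing)
partner-oneRaw-bot ℓ k j with splitAt k (bot j) | splitAt-↑ʳ k k j | lookup-tabulate-of {t = table (oneRaw ℓ k)} refl (bot j)
... | _ | refl | e = e

-- With a vertex present, the walk fuel k + k of compose can be unfolded two more steps.
fuel-spare : ∀ {k} → Fin k → Σ ℕ λ m → k + k ≡ suc (suc m)
fuel-spare {suc k₀} _ = k₀ ℕ.+ k₀ , cong suc (+-suc k₀ k₀)

size : ∀ {k} → Raw k → ℕ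
size d = count (λ v → is-just (partner d v))

inside : ℕ → ℕ → ℕ → Bool
inside p q z = (minℕ p q <ᵇ z) ∧ (z <ᵇ maxℕ p q)

minℕ-≤ : ∀ {p q} → p ≤ q → minℕ p q ≡ p
minℕ-≤ h rewrite ≤ᵇ-true h = refl

maxℕ-≤ : ∀ {p q} → p ≤ q → maxℕ p q ≡ q
maxℕ-≤ h rewrite ≤ᵇ-true h = refl

minℕ-> : ∀ {p q} → q < p → minℕ p q ≡ q
minℕ-> h rewrite ≤ᵇ-false h = refl

maxℕ-> : ∀ {p q} → q < p → maxℕ p q ≡ p
maxℕ-> h rewrite ≤ᵇ-false h = refl

minℕ-comm : ∀ p q → minℕ p q ≡ minℕ q p
minℕ-comm p q with <-cmp p q
... | tri< p<q _ _ rewrite minℕ-≤ (<⇒≤ p<q) | minℕ-> p<q = refl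
... | tri≈ _ refl _ = refl
... | tri> _ _ q<p rewrite minℕ-> q<p | minℕ-≤ (<⇒≤ q<p) = refl

maxℕ-comm : ∀ p q → maxℕ p q ≡ maxℕ q p
maxℕ-comm p q with <-cmp p q
... | tri< p<q _ _ rewrite maxℕ-≤ (<⇒≤ p<q) | maxℕ-> p<q = refl
... | tri≈ _ refl _ = refl
... | tri> _ _ q<p rewrite maxℕ-> q<p | maxℕ-≤ (<⇒≤ q<p) = refl

minℕ≤ˡ : ∀ a b → minℕ a b ≤ a
minℕ≤ˡ a b with <-cmp a b
... | tri< a<b _ _ rewrite minℕ-≤ (<⇒≤ a<b) = ≤-refl
... | tri≈ _ refl _ rewrite minℕ-≤ (≤-refl {a}) = ≤-refl
... | tri> _ _ b<a rewrite minℕ-> b<a = <⇒≤ b<a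

minℕ≤ʳ : ∀ a b → minℕ a b ≤ b
minℕ≤ʳ a b = subst (_≤ b) (minℕ-comm b a) (minℕ≤ˡ b a)

≤maxℕˡ : ∀ a b → a ≤ maxℕ a b
≤maxℕˡ a b with <-cmp a b
... | tri< a<b _ _ rewrite maxℕ-≤ (<⇒≤ a<b) = <⇒≤ a<b
... | tri≈ _ refl _ rewrite maxℕ-≤ (≤-refl {a}) = ≤-refl
... | tri> _ _ b<a rewrite maxℕ-> b<a = ≤-refl

≤maxℕʳ : ∀ a b → b ≤ maxℕ a b
≤maxℕʳ a b = subst (b ≤_) (maxℕ-comm b a) (≤maxℕˡ b a)

minℕ≤maxℕ : ∀ a b → minℕ a b ≤ maxℕ a b
minℕ≤maxℕ a b = ≤-trans (minℕ≤ˡ a b) (≤maxℕˡ a b)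

inside-comm : ∀ p q z → inside p q z ≡ inside q p z
inside-comm p q z rewrite minℕ-comm p q | maxℕ-comm p q = refl

inside-< : ∀ {p q} z → p < q → inside p q z ≡ (p <ᵇ z) ∧ (z <ᵇ q)
inside-< z p<q rewrite minℕ-≤ (<⇒≤ p<q) | maxℕ-≤ (<⇒≤ p<q) = refl

data Region (a b z : ℕ) : Set where
  below   : z < a → Region a b z
  between : a < z → z < b → Region a b z
  above   : b < z → Region a b z

region : ∀ {a b} z → a < b → z ≢ a → z ≢ b → Region a b z
region {a} {b} z a<b z≢a z≢b with <-cmp z a
... | tri< z<a _ _ = below z<a
... | tri≈ _ z≡a _ = ⊥-elim (z≢a z≡a)
... | tri> _ _ a<z with <-cmp z b
...   | tri< z<b _ _ = between a<z z<b
...   | tri≈ _ z≡b _ = ⊥-elim (z≢b z≡b)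
...   | tri> _ _ b<z = above b<z

crosses-sorted : ∀ {a b c e} → a < b → c < e → Region a b c → Region a b e →
  ((a <ᵇ c) ∧ (c <ᵇ b) ∧ (b <ᵇ e)) ∨ ((c <ᵇ a) ∧ (a <ᵇ e) ∧ (e <ᵇ b))
  ≡ (((a <ᵇ c) ∧ (c <ᵇ b)) xor ((a <ᵇ e) ∧ (e <ᵇ b)))
crosses-sorted ab ce (below x) (below y)
  rewrite <ᵇ-false (<⇒≤ x) | <ᵇ-false (<⇒≤ y) | <ᵇ-true x = refl
crosses-sorted ab ce (below x) (between y₁ y₂)
  rewrite <ᵇ-false (<⇒≤ x) | <ᵇ-true x | <ᵇ-true y₁ | <ᵇ-true y₂ = refl
crosses-sorted ab ce (below x) (above y)
  rewrite <ᵇ-false (<⇒≤ x) | <ᵇ-true x | <ᵇ-true (<-trans ab y) | <ᵇ-false (<⇒≤ y) = refl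
crosses-sorted ab ce (between x₁ x₂) (below y) = ⊥-elim (<-asym (<-trans x₁ ce) y)
crosses-sorted ab ce (between x₁ x₂) (between y₁ y₂)
  rewrite <ᵇ-true x₁ | <ᵇ-true x₂ | <ᵇ-true y₁ | <ᵇ-true y₂ | <ᵇ-false (<⇒≤ y₂) | <ᵇ-false (<⇒≤ x₁) = refl
crosses-sorted ab ce (between x₁ x₂) (above y)
  rewrite <ᵇ-true x₁ | <ᵇ-true x₂ | <ᵇ-true y | <ᵇ-true (<-trans ab y) | <ᵇ-false (<⇒≤ y) = refl
crosses-sorted ab ce (above x) (below y) = ⊥-elim (<-asym ce (<-trans (<-trans y ab) x))
crosses-sorted ab ce (above x) (between y₁ y₂) = ⊥-elim (<-asym (<-trans x ce) y₂)
crosses-sorted ab ce (above x) (above y)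
  rewrite <ᵇ-true (<-trans ab x) | <ᵇ-false (<⇒≤ x) | <ᵇ-false (<⇒≤ (<-trans ab x)) | <ᵇ-true (<-trans ab y) | <ᵇ-false (<⇒≤ y) = refl

crosses-sortedˡ : ∀ {a b r s} → a < b → r ≢ s → r ≢ a → r ≢ b → s ≢ a → s ≢ b →
  (let c = minℕ r s ; e = maxℕ r s in
   ((a <ᵇ c) ∧ (c <ᵇ b) ∧ (b <ᵇ e)) ∨ ((c <ᵇ a) ∧ (a <ᵇ e) ∧ (e <ᵇ b)))
  ≡ (((a <ᵇ r) ∧ (r <ᵇ b)) xor ((a <ᵇ s) ∧ (s <ᵇ b)))
crosses-sortedˡ {a} {b} {r} {s} ab rs ra rb sa sb with <-cmp r s
... | tri< r<s _ _ rewrite minℕ-≤ (<⇒≤ r<s) | maxℕ-≤ (<⇒≤ r<s) = crosses-sorted ab r<s (region r ab ra rb) (region s ab sa sb)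
... | tri≈ _ r≡s _ = ⊥-elim (rs r≡s)
... | tri> _ _ s<r rewrite minℕ-> s<r | maxℕ-> s<r =
  trans (crosses-sorted ab s<r (region s ab sa sb) (region r ab ra rb)) (xor-comm ((a <ᵇ s) ∧ (s <ᵇ b)) ((a <ᵇ r) ∧ (r <ᵇ b)))

crosses≡inside-xor : ∀ {p q r s} → p ≢ q → r ≢ s → r ≢ p → r ≢ q → s ≢ p → s ≢ q →
  crosses p q r s ≡ (inside p q r xor inside p q s)
crosses≡inside-xor {p} {q} pq rs rp rq sp sq with <-cmp p q
... | tri< p<q _ _ rewrite minℕ-≤ (<⇒≤ p<q) | maxℕ-≤ (<⇒≤ p<q) = crosses-sortedˡ p<q rs rp rq sp sq
... | tri≈ _ p≡q _ = ⊥-elim (pq p≡q)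
... | tri> _ _ q<p rewrite minℕ-> q<p | maxℕ-> q<p = crosses-sortedˡ q<p rs rq rp sq sp

crosses-self : ∀ p q → crosses p q p q ≡ false
crosses-self p q rewrite <ᵇ-irrefl (minℕ p q) = refl

crosses-reversed : ∀ p q → crosses p q q p ≡ false
crosses-reversed p q rewrite minℕ-comm q p | maxℕ-comm q p = crosses-self p q

crosses-sym : ∀ p q r s → crosses p q r s ≡ crosses r s p q
crosses-sym p q r s = ∨-comm (((minℕ p q) <ᵇ (minℕ r s)) ∧ ((minℕ r s) <ᵇ (maxℕ p q)) ∧ ((maxℕ p q) <ᵇ (maxℕ r s)))
                             (((minℕ r s) <ᵇ (minℕ p q)) ∧ ((minℕ p q) <ᵇ (maxℕ r s)) ∧ ((maxℕ r s) <ᵇ (maxℕ p q)))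

inside-symmetric : ∀ {a b c f} → a ≢ b → c ≢ f → c ≢ a → c ≢ b → f ≢ a → f ≢ b →
  inside a b c ≡ inside a b f → inside c f a ≡ inside c f b
inside-symmetric {a} {b} {c} {f} ab cf ca cb fa fb h = xor≡false⇒≡ (begin
  inside c f a xor inside c f b ≡⟨ sym (crosses≡inside-xor cf ab (≢-sym ca) (≢-sym fa) (≢-sym cb) (≢-sym fb)) ⟩
  crosses c f a b               ≡⟨ crosses-sym c f a b ⟩
  crosses a b c f               ≡⟨ crosses≡inside-xor ab cf ca cb fa fb ⟩
  inside a b c xor inside a b f ≡⟨ cong (_xor inside a b f) h ⟩
  inside a b f xor inside a b f ≡⟨ xor-same (inside a b f) ⟩
  false                         ∎)
  where open ≡-Reasoning

Outside : ℕ → ℕ → ℕ → Set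
Outside a b z = (z < minℕ a b) ⊎ (maxℕ a b < z)

inside-outside : ∀ a b z → Outside a b z → inside a b z ≡ false
inside-outside a b z (inj₁ x) rewrite <ᵇ-false {minℕ a b} {z} (<⇒≤ x) = refl
inside-outside a b z (inj₂ x) rewrite <ᵇ-false {z} {maxℕ a b} (<⇒≤ x) = ∧-zeroʳ _

inside-constant : ∀ {lo hi} c e → lo ≤ hi → Outside lo hi c → Outside lo hi e →
  ∀ z → lo ≤ z → z ≤ hi → inside c e z ≡ inside c e lo
inside-constant {lo} {hi} c e lo≤hi oc oe z lo≤z z≤hi =
  on-ends (minℕ c e) (maxℕ c e) (min-outside) (max-outside) (minℕ≤maxℕ c e)
  where
  strip : ∀ {w} → Outside lo hi w → (w < lo) ⊎ (hi < w)
  strip (inj₁ x) = inj₁ (subst (_ <_) (minℕ-≤ lo≤hi) x)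
  strip (inj₂ x) = inj₂ (subst (_< _) (maxℕ-≤ lo≤hi) x)
  min-outside : (minℕ c e < lo) ⊎ (hi < minℕ c e)
  min-outside with c ≤ᵇ e
  ... | true  = strip oc
  ... | false = strip oe
  max-outside : (maxℕ c e < lo) ⊎ (hi < maxℕ c e)
  max-outside with c ≤ᵇ e
  ... | true  = strip oe
  ... | false = strip oc
  on-ends : ∀ m M → (m < lo) ⊎ (hi < m) → (M < lo) ⊎ (hi < M) → m ≤ M →
            ((m <ᵇ z) ∧ (z <ᵇ M)) ≡ ((m <ᵇ lo) ∧ (lo <ᵇ M))
  on-ends m M (inj₁ a) (inj₁ b) _ rewrite <ᵇ-false {z} {M} (<⇒≤ (<-≤-trans b lo≤z)) | <ᵇ-false {lo} {M} (<⇒≤ b) =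
    trans (∧-zeroʳ _) (sym (∧-zeroʳ _))
  on-ends m M (inj₁ a) (inj₂ b) _ rewrite <ᵇ-true (<-≤-trans a lo≤z) | <ᵇ-true a | <ᵇ-true (≤-<-trans z≤hi b) | <ᵇ-true (≤-<-trans lo≤hi b) = refl
  on-ends m M (inj₂ a) _ _ rewrite <ᵇ-false {m} {z} (<⇒≤ (≤-<-trans z≤hi a)) | <ᵇ-false {m} {lo} (<⇒≤ (≤-<-trans lo≤hi a)) = refl

inside-ends : ∀ a b c e → Outside a b c → Outside a b e → inside c e a ≡ inside c e b
inside-ends a b c e oc oe =
  trans (inside-constant c e le (normal oc) (normal oe) a (minℕ≤ˡ a b) (≤maxℕˡ a b))
        (sym (inside-constant c e le (normal oc) (normal oe) b (minℕ≤ʳ a b) (≤maxℕʳ a b)))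
  where
  le = minℕ≤maxℕ a b
  normal : ∀ {z} → Outside a b z → Outside (minℕ a b) (maxℕ a b) z
  normal (inj₁ x) = inj₁ (subst (_ <_) (sym (minℕ-≤ le)) x)
  normal (inj₂ x) = inj₂ (subst (_< _) (sym (maxℕ-≤ le)) x)

SameChord : ∀ {A : Set} → A → A → A → A → Set
SameChord a b X Y = (a ≡ X × b ≡ Y) ⊎ (a ≡ Y × b ≡ X)

SameChord-orient : ∀ {A B : Set} (F : A → B) {X Y c f} → SameChord c f X Y → F X ≡ F Y → F c ≡ F f
SameChord-orient F (inj₁ (refl , refl)) h = h
SameChord-orient F (inj₂ (refl , refl)) h = sym h

SameChord-unique : ∀ {A : Set} {a b c f X Y : A} → SameChord a b X Y → SameChord c f X Y → c ≢ a → c ≢ b → ⊥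
SameChord-unique (inj₁ (refl , refl)) (inj₁ (refl , _)) c≢a c≢b = c≢a refl
SameChord-unique (inj₁ (refl , refl)) (inj₂ (refl , _)) c≢a c≢b = c≢b refl
SameChord-unique (inj₂ (refl , refl)) (inj₁ (refl , _)) c≢a c≢b = c≢b refl
SameChord-unique (inj₂ (refl , refl)) (inj₂ (refl , _)) c≢a c≢b = c≢a refl

module Traces {c ℓ : Level} (K : CommutativeRing c ℓ) where
  open CommutativeRing K using (Carrier; _≈_; _*_; 1#; *-comm; *-identityˡ; semiring; setoid)
    renaming (_+_ to _⊕_; trans to ≈-trans; reflexive to ≈-reflexive)
  open Matrices K
  open import Algebra.Properties.Semiring.Sum semiring using (sum; sum-cong-≋; ∑-comm; *-distribˡ-sum)
  open import Relation.Binary.Reasoning.Setoid setoid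

  sumFin≡sum : ∀ {n} (f : Fin n → Carrier) → sumFin f ≡ sum f
  sumFin≡sum {zero}  f = refl
  sumFin≡sum {suc n} f = cong (f Fin.zero ⊕_) (sumFin≡sum (λ i → f (Fin.suc i)))

  sumFin²≈sum² : ∀ {n} (f : Fin n → Fin n → Carrier) → sumFin (λ i → sumFin (f i)) ≈ sum (λ i → sum (f i))
  sumFin²≈sum² f = ≈-trans (≈-reflexive (sumFin≡sum (λ i → sumFin (f i)))) (sum-cong-≋ (λ i → ≈-reflexive (sumFin≡sum (f i))))

  trace-cong : ∀ {n} {A B : Mat n} → A ≈M B → trace A ≈ trace B
  trace-cong {A = A} {B} A≈B = begin
    trace A           ≡⟨ sumFin≡sum (λ i → A i i) ⟩
    sum (λ i → A i i) ≈⟨ sum-cong-≋ (λ i → A≈B i i) ⟩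
    sum (λ i → B i i) ≡⟨ sumFin≡sum (λ i → B i i) ⟨
    trace B           ∎

  trace-comm : ∀ {n} (A B : Mat n) → trace (A ⊗ B) ≈ trace (B ⊗ A)
  trace-comm A B = begin
    trace (A ⊗ B)                          ≈⟨ sumFin²≈sum² (λ i t → A i t * B t i) ⟩
    sum (λ i → sum (λ t → A i t * B t i)) ≈⟨ ∑-comm (λ i t → A i t * B t i) ⟩
    sum (λ t → sum (λ i → A i t * B t i)) ≈⟨ sum-cong-≋ (λ t → sum-cong-≋ (λ i → *-comm (A i t) (B t i))) ⟩
    sum (λ t → sum (λ i → B t i * A i t)) ≈⟨ sumFin²≈sum² (λ t i → B t i * A i t) ⟨
    trace (B ⊗ A)                          ∎

  trace-scale : ∀ {n} a (A : Mat n) → trace (a · A) ≈ a * trace A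
  trace-scale a A = begin
    trace (a · A)         ≡⟨ sumFin≡sum (λ i → a * A i i) ⟩
    sum (λ i → a * A i i) ≈⟨ *-distribˡ-sum a (λ i → A i i) ⟨
    a * sum (λ i → A i i) ≡⟨ cong (a *_) (sumFin≡sum (λ i → A i i)) ⟨
    a * trace A           ∎

  trace-rotate : ∀ {x : Carrier} {k n : ℕ} {ρ : Diagram k → Mat n} → IsRep x k n ρ →
    (A B D D′ : Diagram k) → edges D ≡ compose (edges A) (edges B) → loopCount (edges A) (edges B) ≡ 0 →
    edges D′ ≡ compose (edges B) (edges A) → trace (ρ D) ≈ pow x (loopCount (edges B) (edges A)) * trace (ρ D′)
  trace-rotate {x} {ρ = ρ} rep A B D D′ AB≡D no-loop BA≡D′ = begin
    trace (ρ D)                                         ≈⟨ *-identityˡ _ ⟨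
    1# * trace (ρ D)                                    ≈⟨ trace-scale 1# (ρ D) ⟨
    trace (1# · ρ D)                                    ≈⟨ trace-cong (subst (λ κ → (ρ A ⊗ ρ B) ≈M (pow x κ · ρ D)) no-loop (mult A B D AB≡D)) ⟨
    trace (ρ A ⊗ ρ B)                                   ≈⟨ trace-comm (ρ A) (ρ B) ⟩
    trace (ρ B ⊗ ρ A)                                   ≈⟨ trace-cong (mult B A D′ BA≡D′) ⟩
    trace (pow x (loopCount (edges B) (edges A)) · ρ D′) ≈⟨ trace-scale _ (ρ D′) ⟩
    pow x (loopCount (edges B) (edges A)) * trace (ρ D′) ∎
    where open IsRep rep

module _ {k : ℕ} where

  module _ (d : Raw k) where

    Involution : Set
    Involution = ∀ (a b : Vertex k) → partner d a ≡ just b → a ≢ b × partner d b ≡ just a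

    NonCrossing : Set
    NonCrossing = ∀ (a b c e : Vertex k) → partner d a ≡ just b → partner d c ≡ just e →
                  crosses (pos {k} a) (pos {k} b) (pos {k} c) (pos {k} e) ≡ false

    involutive⇒Involution : involutive d ≡ true → Involution
    involutive⇒Involution h a b e with partner d a | allB-elim (λ v → v) h a | e
    ... | just b | ok | refl = not-eqF⇒≢ (proj₁ (∧-split ok)) , eqMF⇒≡ (proj₂ (∧-split ok))

    -- involutive and nonCrossing test each vertex by a function local to Defs that cannot be named here, so the
    -- converse directions refute a failing vertex instead.
    Involution⇒involutive : Involution → involutive d ≡ true
    Involution⇒involutive inv with involutive d in eq
    ... | true  = refl
    ... | false with allB-witness (allFin _) eq
    ...   | a , bad with partner d a in e | bad
    ...     | just b | bad′ with inv a b e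
    ...       | a≢b , eb rewrite eqF-≢ a≢b | ≡⇒eqMF eb with bad′
    ...         | ()

    nonCrossing⇒NonCrossing : nonCrossing d ≡ true → NonCrossing
    nonCrossing⇒NonCrossing h a b c e ea ec with allB-elim (λ v → v) (allB-elim (λ v → v) h a) c
    ... | ok with partner d a | partner d c | ok | ea | ec
    ...   | just b | just e | ok′ | refl | refl = not-true ok′

    NonCrossing⇒nonCrossing : NonCrossing → nonCrossing d ≡ true
    NonCrossing⇒nonCrossing nc with nonCrossing d in eq
    ... | true  = refl
    ... | false with allB-witness (allFin _) eq
    ...   | a , bad with allB-witness (allFin _) bad
    ...     | c , bad′ with partner d a in ea | partner d c in ec | bad′
    ...       | just b | just e | bad″ rewrite nc a b c e ea ec with bad″
    ...         | ()

    isMotzkin-intro : Involution → NonCrossing → T (isMotzkin d)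
    isMotzkin-intro inv nc = ≡true⇒T (∧-pair (Involution⇒involutive inv) (NonCrossing⇒nonCrossing nc))

    isMotzkin⇒Involution : T (isMotzkin d) → Involution
    isMotzkin⇒Involution t = involutive⇒Involution (proj₁ (∧-split (T⇒≡true t)))

    isMotzkin⇒NonCrossing : T (isMotzkin d) → NonCrossing
    isMotzkin⇒NonCrossing t = nonCrossing⇒NonCrossing (proj₂ (∧-split (T⇒≡true t)))


  lastPos : ℕ
  lastPos = k + k ∸ 1

  pos-top : ∀ (i : Fin k) → pos {k} (top i) ≡ toℕ i
  pos-top i rewrite splitAt-↑ˡ k i k = refl

  pos-bot : ∀ (j : Fin k) → pos {k} (bot j) ≡ lastPos ∸ toℕ j
  pos-bot j rewrite splitAt-↑ʳ k k j = refl

  k≤pos-bot : ∀ (u : Fin k) → k ≤ lastPos ∸ toℕ u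
  k≤pos-bot u = begin
      k                      ≡⟨ sym (m+n∸m≡n k k) ⟩
      k + k ∸ k              ≤⟨ ∸-monoʳ-≤ (k + k) (toℕ<n u) ⟩
      k + k ∸ suc (toℕ u)    ≡⟨ sym (∸-+-assoc (k + k) 1 (toℕ u)) ⟩
      lastPos ∸ toℕ u        ∎
    where open Data.Nat.Properties.≤-Reasoning

  toℕ≤lastPos : ∀ (u : Fin k) → toℕ u ≤ lastPos
  toℕ≤lastPos u = ≤-trans (<⇒≤ (toℕ<n u)) (≤-trans (k≤pos-bot u) (m∸n≤m lastPos (toℕ u)))

  pos-top<pos-bot : ∀ (t u : Fin k) → pos {k} (top t) < pos {k} (bot u)
  pos-top<pos-bot t u rewrite pos-top t | pos-bot u = <-≤-trans (toℕ<n t) (k≤pos-bot u)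

  pos-bot<pos-bot : ∀ (p q : Fin k) → toℕ p < toℕ q → pos {k} (bot q) < pos {k} (bot p)
  pos-bot<pos-bot p q p<q rewrite pos-bot p | pos-bot q = ∸-monoʳ-< p<q (toℕ≤lastPos q)

  pos-top<pos-top : ∀ (p q : Fin k) → toℕ p < toℕ q → pos {k} (top p) < pos {k} (top q)
  pos-top<pos-top p q p<q rewrite pos-top p | pos-top q = p<q

  pos-top<ᵇpos-top : ∀ (t t′ : Fin k) → (pos {k} (top t) <ᵇ pos {k} (top t′)) ≡ (toℕ t <ᵇ toℕ t′)
  pos-top<ᵇpos-top t t′ rewrite pos-top t | pos-top t′ = refl

  pos-top<ᵇpos-bot : ∀ (t u : Fin k) → (pos {k} (top t) <ᵇ pos {k} (bot u)) ≡ true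
  pos-top<ᵇpos-bot t u = <ᵇ-true (pos-top<pos-bot t u)

  pos-bot<ᵇpos-top : ∀ (u t : Fin k) → (pos {k} (bot u) <ᵇ pos {k} (top t)) ≡ false
  pos-bot<ᵇpos-top u t = <ᵇ-false (<⇒≤ (pos-top<pos-bot t u))

  pos-bot<ᵇpos-bot : ∀ (u u′ : Fin k) → (pos {k} (bot u) <ᵇ pos {k} (bot u′)) ≡ (toℕ u′ <ᵇ toℕ u)
  pos-bot<ᵇpos-bot u u′ with <-cmp (toℕ u′) (toℕ u)
  ... | tri< u′<u _ _ rewrite <ᵇ-true u′<u = <ᵇ-true (pos-bot<pos-bot u′ u u′<u)
  ... | tri≈ _ e _ rewrite e | <ᵇ-irrefl (toℕ u) | toℕ-injective e = <ᵇ-irrefl (pos {k} (bot u))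
  ... | tri> _ _ u<u′ rewrite <ᵇ-false (<⇒≤ u<u′) = <ᵇ-false (<⇒≤ (pos-bot<pos-bot u u′ u<u′))

  pos-injective : ∀ (v w : Vertex k) → pos {k} v ≡ pos {k} w → v ≡ w
  pos-injective v w e with view {k} v | view {k} w
  ... | vtop i | vtop j = cong top (toℕ-injective (trans (sym (pos-top i)) (trans e (pos-top j))))
  ... | vtop i | vbot j = ⊥-elim (<-irrefl e (pos-top<pos-bot i j))
  ... | vbot i | vtop j = ⊥-elim (<-irrefl (sym e) (pos-top<pos-bot j i))
  ... | vbot i | vbot j =
    cong bot (toℕ-injective (∸-cancelˡ-≡ (toℕ≤lastPos i) (toℕ≤lastPos j) (trans (sym (pos-bot i)) (trans e (pos-bot j)))))

  pos-≢ : ∀ {v w : Vertex k} → v ≢ w → pos {k} v ≢ pos {k} w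
  pos-≢ v≢w e = v≢w (pos-injective _ _ e)

  insideChord : Vertex k → Vertex k → Vertex k → Bool
  insideChord a b z = inside (pos {k} a) (pos {k} b) (pos {k} z)

  insideChord-comm : ∀ (a b z : Vertex k) → insideChord a b z ≡ insideChord b a z
  insideChord-comm a b z = inside-comm (pos {k} a) (pos {k} b) (pos {k} z)

  insideChord-through-top : ∀ (a b t : Fin k) → insideChord (top a) (bot b) (top t) ≡ (toℕ a <ᵇ toℕ t)
  insideChord-through-top a b t
    rewrite inside-< (pos {k} (top t)) (pos-top<pos-bot a b) | pos-top<ᵇpos-top a t | pos-top<ᵇpos-bot t b = ∧-identityʳ _

  insideChord-through-bot : ∀ (a b u : Fin k) → insideChord (top a) (bot b) (bot u) ≡ (toℕ b <ᵇ toℕ u)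
  insideChord-through-bot a b u
    rewrite inside-< (pos {k} (bot u)) (pos-top<pos-bot a b) | pos-top<ᵇpos-bot a u | pos-bot<ᵇpos-bot u b = refl

  insideChord-cap-top : ∀ (p q t : Fin k) → toℕ p < toℕ q →
                        insideChord (top p) (top q) (top t) ≡ (toℕ p <ᵇ toℕ t) ∧ (toℕ t <ᵇ toℕ q)
  insideChord-cap-top p q t p<q
    rewrite inside-< (pos {k} (top t)) (pos-top<pos-top p q p<q) | pos-top<ᵇpos-top p t | pos-top<ᵇpos-top t q = refl

  insideChord-cap-bot : ∀ (p q u : Fin k) → toℕ p < toℕ q → insideChord (top p) (top q) (bot u) ≡ false
  insideChord-cap-bot p q u p<q
    rewrite inside-< (pos {k} (bot u)) (pos-top<pos-top p q p<q) | pos-top<ᵇpos-bot p u | pos-bot<ᵇpos-top u q = refl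

  insideChord-cup-top : ∀ (p q t : Fin k) → toℕ p < toℕ q → insideChord (bot p) (bot q) (top t) ≡ false
  insideChord-cup-top p q t p<q
    rewrite insideChord-comm (bot p) (bot q) (top t) | inside-< (pos {k} (top t)) (pos-bot<pos-bot p q p<q)
          | pos-bot<ᵇpos-top q t = refl

  insideChord-cup-bot : ∀ (p q u : Fin k) → toℕ p < toℕ q →
                        insideChord (bot p) (bot q) (bot u) ≡ (toℕ u <ᵇ toℕ q) ∧ (toℕ p <ᵇ toℕ u)
  insideChord-cup-bot p q u p<q
    rewrite insideChord-comm (bot p) (bot q) (bot u) | inside-< (pos {k} (bot u)) (pos-bot<pos-bot p q p<q)
          | pos-bot<ᵇpos-bot q u | pos-bot<ᵇpos-bot u p = refl

  other-ends-≢ : (d : Raw k) → Involution d → ∀ {a b c f} → partner d a ≡ just b → partner d c ≡ just f →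
                 c ≢ a → c ≢ b → f ≢ a × f ≢ b
  other-ends-≢ d inv ea ec c≢a c≢b =
    (λ { refl → c≢b (just-injective (trans (sym (proj₂ (inv _ _ ec))) ea)) }) ,
    (λ { refl → c≢a (just-injective (trans (sym (proj₂ (inv _ _ ec))) (proj₂ (inv _ _ ea)))) })

  NonCrossing-intro : (d : Raw k) → Involution d →
    (∀ a b c f → partner d a ≡ just b → partner d c ≡ just f → c ≢ a → c ≢ b → insideChord a b c ≡ insideChord a b f) →
    NonCrossing d
  NonCrossing-intro d inv h a b c f ea ec with c Fin.≟ a
  ... | yes refl = subst (λ z → crosses (pos {k} a) (pos {k} b) (pos {k} a) (pos {k} z) ≡ false)
                         (just-injective (trans (sym ea) ec)) (crosses-self (pos {k} a) (pos {k} b))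
  ... | no c≢a with c Fin.≟ b
  ...   | yes refl = subst (λ z → crosses (pos {k} a) (pos {k} b) (pos {k} b) (pos {k} z) ≡ false)
                           (just-injective (trans (sym (proj₂ (inv a b ea))) ec)) (crosses-reversed (pos {k} a) (pos {k} b))
  ...   | no c≢b = trans (crosses≡inside-xor (pos-≢ (proj₁ (inv a b ea))) (pos-≢ (proj₁ (inv c f ec)))
                                             (pos-≢ c≢a) (pos-≢ c≢b) (pos-≢ f≢a) (pos-≢ f≢b))
                         (trans (cong (_xor insideChord a b f) (h a b c f ea ec c≢a c≢b)) (xor-same (insideChord a b f)))
    where open Σ (other-ends-≢ d inv ea ec c≢a c≢b) renaming (proj₁ to f≢a; proj₂ to f≢b)

  NonCrossing⇒insideChord : (d : Raw k) → Involution d → NonCrossing d →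
    ∀ a b c f → partner d a ≡ just b → partner d c ≡ just f → c ≢ a → c ≢ b → insideChord a b c ≡ insideChord a b f
  NonCrossing⇒insideChord d inv nc a b c f ea ec c≢a c≢b =
    xor≡false⇒≡ (trans (sym (crosses≡inside-xor (pos-≢ (proj₁ (inv a b ea))) (pos-≢ (proj₁ (inv c f ec)))
                                                 (pos-≢ c≢a) (pos-≢ c≢b) (pos-≢ f≢a) (pos-≢ f≢b))) (nc a b c f ea ec))
    where open Σ (other-ends-≢ d inv ea ec c≢a c≢b) renaming (proj₁ to f≢a; proj₂ to f≢b)

  module Walk (d₁ d₂ : Raw k) where
    open Compose d₁ d₂ public

    fuel′ : ℕ
    fuel′ = suc (k + k)

    from2-bot : ∀ f (j i : Fin k) → partner d₂ (top j) ≡ just (bot i) → from2 (suc f) j ≡ just (bot i)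
    from2-bot f j i eq rewrite eq | splitAt-↑ʳ k k i = refl

    from2-top : ∀ f (j j′ : Fin k) → partner d₂ (top j) ≡ just (top j′) → from2 (suc f) j ≡ from1 f j′
    from2-top f j j′ eq rewrite eq | splitAt-↑ˡ k j′ k = refl

    from2-isolated : ∀ f (j : Fin k) → partner d₂ (top j) ≡ nothing → from2 (suc f) j ≡ nothing
    from2-isolated f j eq rewrite eq = refl

    from1-top : ∀ f (j i : Fin k) → partner d₁ (bot j) ≡ just (top i) → from1 (suc f) j ≡ just (top i)
    from1-top f j i eq rewrite eq | splitAt-↑ˡ k i k = refl

    from1-bot : ∀ f (j j′ : Fin k) → partner d₁ (bot j) ≡ just (bot j′) → from1 (suc f) j ≡ from2 f j′
    from1-bot f j j′ eq rewrite eq | splitAt-↑ʳ k k j′ = refl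

    from1-isolated : ∀ f (j : Fin k) → partner d₁ (bot j) ≡ nothing → from1 (suc f) j ≡ nothing
    from1-isolated f j eq rewrite eq = refl

    out-top-isolated : ∀ (i : Fin k) → partner d₁ (top i) ≡ nothing → outPartner (top i) ≡ nothing
    out-top-isolated i eq rewrite splitAt-↑ˡ k i k | eq = refl

    out-top-top : ∀ (i i′ : Fin k) → partner d₁ (top i) ≡ just (top i′) → outPartner (top i) ≡ just (top i′)
    out-top-top i i′ eq rewrite splitAt-↑ˡ k i k | eq | splitAt-↑ˡ k i′ k = refl

    out-top-bot : ∀ (i j : Fin k) → partner d₁ (top i) ≡ just (bot j) → outPartner (top i) ≡ from2 fuel j
    out-top-bot i j eq rewrite splitAt-↑ˡ k i k | eq | splitAt-↑ʳ k k j = refl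

    out-bot-isolated : ∀ (i : Fin k) → partner d₂ (bot i) ≡ nothing → outPartner (bot i) ≡ nothing
    out-bot-isolated i eq rewrite splitAt-↑ʳ k k i | eq = refl

    out-bot-bot : ∀ (i i′ : Fin k) → partner d₂ (bot i) ≡ just (bot i′) → outPartner (bot i) ≡ just (bot i′)
    out-bot-bot i i′ eq rewrite splitAt-↑ʳ k k i | eq | splitAt-↑ʳ k k i′ = refl

    out-bot-top : ∀ (i j : Fin k) → partner d₂ (bot i) ≡ just (top j) → outPartner (bot i) ≡ from1 fuel j
    out-bot-top i j eq rewrite splitAt-↑ʳ k k i | eq | splitAt-↑ˡ k j k = refl

    NoMiddleLoop : Set
    NoMiddleLoop = ∀ (j j′ j″ : Fin k) → partner d₁ (bot j) ≡ just (bot j′) → partner d₂ (top j′) ≡ just (top j″) → ⊥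

    g-nothing : NoMiddleLoop → ∀ j → g j ≡ nothing
    g-nothing none j with partner d₁ (bot j) in e₁
    ... | nothing = refl
    ... | just w with view {k} w
    ...   | vtop i rewrite splitAt-↑ˡ k i k = refl
    ...   | vbot j′ rewrite splitAt-↑ʳ k k j′ with partner d₂ (top j′) in e₂
    ...     | nothing = refl
    ...     | just w′ with view {k} w′
    ...       | vtop j″ = ⊥-elim (none j j′ j″ e₁ e₂)
    ...       | vbot i rewrite splitAt-↑ʳ k k i = refl

    giter-nothing : NoMiddleLoop → ∀ n j → giter (suc n) j ≡ nothing
    giter-nothing none zero    j = g-nothing none j
    giter-nothing none (suc n) j rewrite giter-nothing none n j = refl

    loops-none : NoMiddleLoop → loops ≡ 0
    loops-none none = no-filtered (allFin k)
      where
      off-loop : ∀ j → onLoop j ≡ false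
      off-loop j = anyB-false (λ n → cong (λ m → eqMF m (just j)) (giter-nothing none n j)) (List.upTo k)
      no-filtered : ∀ xs → length (filter (λ j → T? (onLoop j ∧ isMinOfLoop j)) xs) ≡ 0
      no-filtered []       = refl
      no-filtered (x ∷ xs) rewrite off-loop x = no-filtered xs


  insideChord-SameChord : ∀ {X Y a b : Vertex k} → SameChord a b X Y → ∀ z → insideChord a b z ≡ insideChord X Y z
  insideChord-SameChord (inj₁ (refl , refl)) z = refl
  insideChord-SameChord (inj₂ (refl , refl)) z = insideChord-comm _ _ z

  Vertical : Fin k → Vertex k → Vertex k → Set
  Vertical i a b = SameChord a b (top i) (bot i)

  insideChord-chords : ∀ {X Y U V a b c f : Vertex k} → SameChord a b X Y → SameChord c f U V →
                       insideChord X Y U ≡ insideChord X Y V → insideChord a b c ≡ insideChord a b f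
  insideChord-chords {X} {Y} {c = c} {f} ab cf h =
    trans (insideChord-SameChord ab c) (trans (SameChord-orient (insideChord X Y) cf h) (sym (insideChord-SameChord ab f)))

  vertical-separates-not : ∀ {i j a b c f} → Vertical i a b → Vertical j c f → insideChord a b c ≡ insideChord a b f
  vertical-separates-not {i} {j} v w =
    insideChord-chords v w (trans (insideChord-through-top i i j) (sym (insideChord-through-bot i i j)))

  partialIdTop partialIdBot : (Fin k → Bool) → Fin k → Maybe (Vertex k)
  partialIdTop S i = if S i then just (bot i) else nothing
  partialIdBot S j = if S j then just (top j) else nothing

  partialId : (Fin k → Bool) → Raw k
  partialId S = rawByRow (partialIdTop S) (partialIdBot S)

  partialId-top-in : ∀ S i → S i ≡ true → partner (partialId S) (top i) ≡ just (bot i)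
  partialId-top-in S i e = trans (partner-rawByRow-top (partialIdTop S) (partialIdBot S) i) (cong (λ b → if b then just (bot i) else nothing) e)

  partialId-top-out : ∀ S i → S i ≡ false → partner (partialId S) (top i) ≡ nothing
  partialId-top-out S i e = trans (partner-rawByRow-top (partialIdTop S) (partialIdBot S) i) (cong (λ b → if b then just (bot i) else nothing) e)

  partialId-bot-in : ∀ S i → S i ≡ true → partner (partialId S) (bot i) ≡ just (top i)
  partialId-bot-in S i e = trans (partner-rawByRow-bot (partialIdTop S) (partialIdBot S) i) (cong (λ b → if b then just (top i) else nothing) e)

  partialId-bot-out : ∀ S i → S i ≡ false → partner (partialId S) (bot i) ≡ nothing
  partialId-bot-out S i e = trans (partner-rawByRow-bot (partialIdTop S) (partialIdBot S) i) (cong (λ b → if b then just (top i) else nothing) e)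

  partialId-edge : ∀ S a b → partner (partialId S) a ≡ just b → Σ (Fin k) λ i → S i ≡ true × Vertical i a b
  partialId-edge S a b e with view {k} a
  ... | vtop i with S i in s
  ...   | true  = i , s , inj₁ (refl , just-injective (trans (sym e) (partialId-top-in S i s)))
  ...   | false = ⊥-elim (nothing≢just (trans (sym (partialId-top-out S i s)) e))
  partialId-edge S a b e | vbot i with S i in s
  ...   | true  = i , s , inj₂ (refl , just-injective (trans (sym e) (partialId-bot-in S i s)))
  ...   | false = ⊥-elim (nothing≢just (trans (sym (partialId-bot-out S i s)) e))

  partialId-isMotzkin : ∀ S → T (isMotzkin (partialId S))
  partialId-isMotzkin S = isMotzkin-intro (partialId S) inv (NonCrossing-intro (partialId S) inv
    (λ a b c f ea ec _ _ → vertical-separates-not (proj₂ (proj₂ (partialId-edge S a b ea))) (proj₂ (proj₂ (partialId-edge S c f ec)))))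
    where
    inv : Involution (partialId S)
    inv a b e with partialId-edge S a b e
    ... | i , s , inj₁ (refl , refl) = top≢bot , partialId-bot-in S i s
    ... | i , s , inj₂ (refl , refl) = bot≢top , partialId-top-in S i s

  partialId-cong : ∀ {S S′} → (∀ j → S j ≡ S′ j) → partialId S ≡ partialId S′
  partialId-cong {S} {S′} h = raw-tabulate-cong same
    where
    same : ∀ v → byRow (partialIdTop S) (partialIdBot S) v ≡ byRow (partialIdTop S′) (partialIdBot S′) v
    same v with splitAt k v
    ... | inj₁ i rewrite h i = refl
    ... | inj₂ j rewrite h j = refl

  unlessTo : Vertex k → Maybe (Vertex k) → Maybe (Vertex k)
  unlessTo z nothing  = nothing
  unlessTo z (just w) = if eqF w z then nothing else just w

  unlessTo-self : ∀ z → unlessTo z (just z) ≡ nothing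
  unlessTo-self z rewrite eqF-refl z = refl

  unlessTo-≢ : ∀ z w → w ≢ z → unlessTo z (just w) ≡ just w
  unlessTo-≢ z w w≢z rewrite eqF-≢ w≢z = refl

  dropEdgePartner : Raw k → Vertex k → Vertex k → Maybe (Vertex k)
  dropEdgePartner d z v = if eqF v z then nothing else unlessTo z (partner d v)

  dropEdge : Raw k → Vertex k → Raw k
  dropEdge d z = raw (tabulate (dropEdgePartner d z))

  partner-dropEdge : ∀ d z v → partner (dropEdge d z) v ≡ dropEdgePartner d z v
  partner-dropEdge d z v = lookup∘tabulate (dropEdgePartner d z) v

  partner-dropEdge-self : ∀ d z → partner (dropEdge d z) z ≡ nothing
  partner-dropEdge-self d z rewrite partner-dropEdge d z z | eqF-refl z = refl

  partner-dropEdge-≢ : ∀ d z v → v ≢ z → partner (dropEdge d z) v ≡ unlessTo z (partner d v)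
  partner-dropEdge-≢ d z v v≢z rewrite partner-dropEdge d z v | eqF-≢ v≢z = refl

  partner-dropEdge-via : ∀ d z v {m} → v ≢ z → partner d v ≡ m → partner (dropEdge d z) v ≡ unlessTo z m
  partner-dropEdge-via d z v v≢z e = trans (partner-dropEdge-≢ d z v v≢z) (cong (unlessTo z) e)

  dropEdge-⊆ : ∀ d z v w → partner (dropEdge d z) v ≡ just w → partner d v ≡ just w × v ≢ z × w ≢ z
  dropEdge-⊆ d z v w e with v Fin.≟ z
  ... | yes refl = ⊥-elim (nothing≢just (trans (sym (partner-dropEdge-self d z)) e))
  ... | no v≢z with partner d v in eq | trans (sym e) (partner-dropEdge-≢ d z v v≢z)
  ...   | nothing | ()
  ...   | just w′ | h with w′ Fin.≟ z | h
  ...     | yes refl | ()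
  ...     | no w′≢z  | refl = refl , v≢z , w′≢z

  dropEdge-keeps : ∀ d z v w → v ≢ z → partner d v ≡ just w → w ≢ z → partner (dropEdge d z) v ≡ just w
  dropEdge-keeps d z v w v≢z e w≢z = trans (partner-dropEdge-≢ d z v v≢z) (trans (cong (unlessTo z) e) (unlessTo-≢ z w w≢z))

  dropEdge-isMotzkin : ∀ d z → T (isMotzkin d) → T (isMotzkin (dropEdge d z))
  dropEdge-isMotzkin d z t = isMotzkin-intro (dropEdge d z) inv nc
    where
    inv : Involution (dropEdge d z)
    inv a b e with dropEdge-⊆ d z a b e
    ... | ea , a≢z , b≢z = proj₁ (isMotzkin⇒Involution d t a b ea) , dropEdge-keeps d z b a b≢z (proj₂ (isMotzkin⇒Involution d t a b ea)) a≢z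
    nc : NonCrossing (dropEdge d z)
    nc a b c f ea ec = isMotzkin⇒NonCrossing d t a b c f (proj₁ (dropEdge-⊆ d z a b ea)) (proj₁ (dropEdge-⊆ d z c f ec))

  dropEdge-isolated : ∀ d z → Involution d → partner d z ≡ nothing → dropEdge d z ≡ d
  dropEdge-isolated d z inv ez = raw-tabulate-partner d same
    where
    same : ∀ v → dropEdgePartner d z v ≡ partner d v
    same v with v Fin.≟ z
    ... | yes refl = sym ez
    ... | no v≢z with partner d v in eq
    ...   | nothing = refl
    ...   | just w with w Fin.≟ z
    ...     | yes refl = ⊥-elim (nothing≢just (trans (sym ez) (proj₂ (inv v z eq))))
    ...     | no _ = refl

  is-just-just : ∀ {m : Maybe (Vertex k)} {w} → m ≡ just w → is-just m ≡ true
  is-just-just refl = refl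

  size-dropEdge : ∀ d z w → partner d z ≡ just w → size (dropEdge d z) < size d
  size-dropEdge d z w ez = count-mono-< fewer z (cong is-just (partner-dropEdge-self d z)) (is-just-just ez)
    where
    fewer : ∀ v → is-just (partner (dropEdge d z) v) ≡ true → is-just (partner d v) ≡ true
    fewer v h with partner (dropEdge d z) v in e
    ... | just w′ = is-just-just (proj₁ (dropEdge-⊆ d z v w′ e))

  allBut : Fin k → Fin k → Bool
  allBut c j = not (eqF j c)

  allBut-self : ∀ c → allBut c c ≡ false
  allBut-self c rewrite eqF-refl c = refl

  allBut-≢ : ∀ c j → j ≢ c → allBut c j ≡ true
  allBut-≢ c j j≢c rewrite eqF-≢ j≢c = refl

  idExcept : Fin k → Raw k
  idExcept c = partialId (allBut c)

  noMiddleLoop-idExcept-left : ∀ c d → Walk.NoMiddleLoop (idExcept c) d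
  noMiddleLoop-idExcept-left c d j j′ j″ e₁ e₂ with allBut c j in s
  ... | true  = top≢bot (just-injective (trans (sym (partialId-bot-in (allBut c) j s)) e₁))
  ... | false = nothing≢just (trans (sym (partialId-bot-out (allBut c) j s)) e₁)

  noMiddleLoop-idExcept-right : ∀ c d → Walk.NoMiddleLoop d (idExcept c)
  noMiddleLoop-idExcept-right c d j j′ j″ e₁ e₂ with allBut c j′ in s
  ... | true  = bot≢top (just-injective (trans (sym (partialId-top-in (allBut c) j′ s)) e₂))
  ... | false = nothing≢just (trans (sym (partialId-top-out (allBut c) j′ s)) e₂)

  compose-idExcept-left : ∀ c d → compose (idExcept c) d ≡ dropEdge d (top c)
  compose-idExcept-left c d = raw-tabulate-partner (dropEdge d (top c)) same
    where
    open Walk (idExcept c) d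
    through : ∀ i → i ≢ c → partner (idExcept c) (top i) ≡ just (bot i)
    through i i≢c = partialId-top-in (allBut c) i (allBut-≢ c i i≢c)
    into : ∀ i → i ≢ c → partner (idExcept c) (bot i) ≡ just (top i)
    into i i≢c = partialId-bot-in (allBut c) i (allBut-≢ c i i≢c)
    blocked : partner (idExcept c) (bot c) ≡ nothing
    blocked = partialId-bot-out (allBut c) c (allBut-self c)
    same : ∀ v → outPartner v ≡ partner (dropEdge d (top c)) v
    same v with view {k} v
    ... | vtop i with i Fin.≟ c
    ...   | yes refl = trans (out-top-isolated i (partialId-top-out (allBut c) i (allBut-self c))) (sym (partner-dropEdge-self d (top c)))
    ...   | no i≢c with partnerView {k} (partner d (top i))
    ...     | isolated e = trans (out-top-bot i i (through i i≢c))
                             (trans (from2-isolated fuel′ i e) (sym (partner-dropEdge-via d (top c) (top i) (top-≢ i≢c) e)))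
    ...     | toBot j e = trans (out-top-bot i i (through i i≢c))
                             (trans (from2-bot fuel′ i j e) (sym (trans (partner-dropEdge-via d (top c) (top i) (top-≢ i≢c) e) (unlessTo-≢ _ _ bot≢top))))
    ...     | toTop i′ e with i′ Fin.≟ c
    ...       | yes refl = trans (out-top-bot i i (through i i≢c))
                             (trans (from2-top fuel′ i c e) (trans (from1-isolated (k + k) c blocked)
                               (sym (trans (partner-dropEdge-via d (top c) (top i) (top-≢ i≢c) e) (unlessTo-self (top c))))))
    ...       | no i′≢c = trans (out-top-bot i i (through i i≢c))
                             (trans (from2-top fuel′ i i′ e) (trans (from1-top (k + k) i′ i′ (into i′ i′≢c))
                               (sym (trans (partner-dropEdge-via d (top c) (top i) (top-≢ i≢c) e) (unlessTo-≢ _ _ (top-≢ i′≢c))))))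
    same v | vbot u with partnerView {k} (partner d (bot u))
    ...   | isolated e = trans (out-bot-isolated u e) (sym (partner-dropEdge-via d (top c) (bot u) bot≢top e))
    ...   | toBot u′ e = trans (out-bot-bot u u′ e) (sym (trans (partner-dropEdge-via d (top c) (bot u) bot≢top e) (unlessTo-≢ _ _ bot≢top)))
    ...   | toTop j e with j Fin.≟ c
    ...     | yes refl = trans (out-bot-top u c e) (trans (from1-isolated fuel′ c blocked)
                           (sym (trans (partner-dropEdge-via d (top c) (bot u) bot≢top e) (unlessTo-self (top c)))))
    ...     | no j≢c = trans (out-bot-top u j e) (trans (from1-top fuel′ j j (into j j≢c))
                           (sym (trans (partner-dropEdge-via d (top c) (bot u) bot≢top e) (unlessTo-≢ _ _ (top-≢ j≢c)))))

  compose-idExcept-right : ∀ c d → compose d (idExcept c) ≡ dropEdge d (bot c)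
  compose-idExcept-right c d = raw-tabulate-partner (dropEdge d (bot c)) same
    where
    open Walk d (idExcept c)
    through : ∀ i → i ≢ c → partner (idExcept c) (bot i) ≡ just (top i)
    through i i≢c = partialId-bot-in (allBut c) i (allBut-≢ c i i≢c)
    into : ∀ i → i ≢ c → partner (idExcept c) (top i) ≡ just (bot i)
    into i i≢c = partialId-top-in (allBut c) i (allBut-≢ c i i≢c)
    blocked : partner (idExcept c) (top c) ≡ nothing
    blocked = partialId-top-out (allBut c) c (allBut-self c)
    same : ∀ v → outPartner v ≡ partner (dropEdge d (bot c)) v
    same v with view {k} v
    ... | vtop i with partnerView {k} (partner d (top i))
    ...   | isolated e = trans (out-top-isolated i e) (sym (partner-dropEdge-via d (bot c) (top i) top≢bot e))
    ...   | toTop i′ e = trans (out-top-top i i′ e) (sym (trans (partner-dropEdge-via d (bot c) (top i) top≢bot e) (unlessTo-≢ _ _ top≢bot)))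
    ...   | toBot j e with j Fin.≟ c
    ...     | yes refl = trans (out-top-bot i c e) (trans (from2-isolated fuel′ c blocked)
                           (sym (trans (partner-dropEdge-via d (bot c) (top i) top≢bot e) (unlessTo-self (bot c)))))
    ...     | no j≢c = trans (out-top-bot i j e) (trans (from2-bot fuel′ j j (into j j≢c))
                           (sym (trans (partner-dropEdge-via d (bot c) (top i) top≢bot e) (unlessTo-≢ _ _ (bot-≢ j≢c)))))
    same v | vbot u with u Fin.≟ c
    ...   | yes refl = trans (out-bot-isolated c (partialId-bot-out (allBut c) c (allBut-self c))) (sym (partner-dropEdge-self d (bot c)))
    ...   | no u≢c with partnerView {k} (partner d (bot u))
    ...     | isolated e = trans (out-bot-top u u (through u u≢c))
                             (trans (from1-isolated fuel′ u e) (sym (partner-dropEdge-via d (bot c) (bot u) (bot-≢ u≢c) e)))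
    ...     | toTop i e = trans (out-bot-top u u (through u u≢c))
                             (trans (from1-top fuel′ u i e) (sym (trans (partner-dropEdge-via d (bot c) (bot u) (bot-≢ u≢c) e) (unlessTo-≢ _ _ top≢bot))))
    ...     | toBot j e with j Fin.≟ c
    ...       | yes refl = trans (out-bot-top u u (through u u≢c))
                             (trans (from1-bot fuel′ u c e) (trans (from2-isolated (k + k) c blocked)
                               (sym (trans (partner-dropEdge-via d (bot c) (bot u) (bot-≢ u≢c) e) (unlessTo-self (bot c))))))
    ...       | no j≢c = trans (out-bot-top u u (through u u≢c))
                             (trans (from1-bot fuel′ u j e) (trans (from2-bot (k + k) j j (into j j≢c))
                               (sym (trans (partner-dropEdge-via d (bot c) (bot u) (bot-≢ u≢c) e) (unlessTo-≢ _ _ (bot-≢ j≢c))))))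

  -- d with the edge R₁–R₂ deleted and the edges P₁–x, P₂–y replaced by P₁–P₂ and x–y; `out` says that every
  -- other edge keeps clear of the span of P₁ and P₂, which is what keeps the result non-crossing.
  module Merge (d : Raw k) (valid : T (isMotzkin d)) (P₁ P₂ R₁ R₂ x y : Vertex k)
    (P₁≢P₂ : P₁ ≢ P₂) (eR : partner d R₁ ≡ just R₂)
    (P₁≢R₁ : P₁ ≢ R₁) (P₁≢R₂ : P₁ ≢ R₂) (P₂≢R₁ : P₂ ≢ R₁) (P₂≢R₂ : P₂ ≢ R₂)
    (ex : partner d P₁ ≡ just x) (ey : partner d P₂ ≡ just y)
    (out : ∀ z w → partner d z ≡ just w → z ≢ R₁ → z ≢ R₂ → z ≢ P₁ → z ≢ P₂ → Outside (pos {k} P₁) (pos {k} P₂) (pos {k} z))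
    where

    inv : Involution d
    inv = isMotzkin⇒Involution d valid

    nc : NonCrossing d
    nc = isMotzkin⇒NonCrossing d valid

    redirect : Maybe (Vertex k) → Maybe (Vertex k)
    redirect nothing = nothing
    redirect (just w) = if eqF w P₁ then just y else if eqF w P₂ then just x else just w

    mergedPartner : Vertex k → Maybe (Vertex k)
    mergedPartner v = if eqF v R₁ ∨ eqF v R₂ then nothing else if eqF v P₁ then just P₂ else if eqF v P₂ then just P₁ else redirect (partner d v)

    merged : Raw k
    merged = raw (tabulate mergedPartner)

    partner-merged : ∀ v → partner merged v ≡ mergedPartner v
    partner-merged v = lookup∘tabulate mergedPartner v

    R₁≢R₂ : R₁ ≢ R₂
    R₁≢R₂ = proj₁ (inv R₁ R₂ eR)
    eR′ : partner d R₂ ≡ just R₁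
    eR′ = proj₂ (inv R₁ R₂ eR)
    ex′ : partner d x ≡ just P₁
    ex′ = proj₂ (inv P₁ x ex)
    ey′ : partner d y ≡ just P₂
    ey′ = proj₂ (inv P₂ y ey)
    x≢R₁ : x ≢ R₁
    x≢R₁ refl = P₁≢R₂ (just-injective (trans (sym ex′) eR))
    x≢R₂ : x ≢ R₂
    x≢R₂ refl = P₁≢R₁ (just-injective (trans (sym ex′) eR′))
    y≢R₁ : y ≢ R₁
    y≢R₁ refl = P₂≢R₂ (just-injective (trans (sym ey′) eR))
    y≢R₂ : y ≢ R₂
    y≢R₂ refl = P₂≢R₁ (just-injective (trans (sym ey′) eR′))
    x≢P₁ : x ≢ P₁
    x≢P₁ e = proj₁ (inv P₁ x ex) (sym e)
    y≢P₂ : y ≢ P₂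
    y≢P₂ e = proj₁ (inv P₂ y ey) (sym e)
    x≢y : x ≢ y
    x≢y refl = P₁≢P₂ (just-injective (trans (sym ex′) ey′))

    mergedPartner-R₁ : mergedPartner R₁ ≡ nothing
    mergedPartner-R₁ rewrite eqF-refl R₁ = refl
    mergedPartner-R₂ : mergedPartner R₂ ≡ nothing
    mergedPartner-R₂ rewrite eqF-refl R₂ | eqF-≢ (≢-sym R₁≢R₂) = refl
    mergedPartner-P₁ : mergedPartner P₁ ≡ just P₂
    mergedPartner-P₁ rewrite eqF-≢ P₁≢R₁ | eqF-≢ P₁≢R₂ | eqF-refl P₁ = refl
    mergedPartner-P₂ : mergedPartner P₂ ≡ just P₁
    mergedPartner-P₂ rewrite eqF-≢ P₂≢R₁ | eqF-≢ P₂≢R₂ | eqF-≢ (≢-sym P₁≢P₂) | eqF-refl P₂ = refl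
    mergedPartner-other : ∀ v → v ≢ R₁ → v ≢ R₂ → v ≢ P₁ → v ≢ P₂ → mergedPartner v ≡ redirect (partner d v)
    mergedPartner-other v a b c e rewrite eqF-≢ a | eqF-≢ b | eqF-≢ c | eqF-≢ e = refl
    redirect-P₁ : redirect (just P₁) ≡ just y
    redirect-P₁ rewrite eqF-refl P₁ = refl
    redirect-P₂ : redirect (just P₂) ≡ just x
    redirect-P₂ rewrite eqF-≢ (≢-sym P₁≢P₂) | eqF-refl P₂ = refl
    redirect-other : ∀ w → w ≢ P₁ → w ≢ P₂ → redirect (just w) ≡ just w
    redirect-other w a b rewrite eqF-≢ a | eqF-≢ b = refl

    data VertexClass (v : Vertex k) : Set where
      isR₁ : v ≡ R₁ → VertexClass v
      isR₂ : v ≡ R₂ → VertexClass v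
      isP₁ : v ≡ P₁ → VertexClass v
      isP₂ : v ≡ P₂ → VertexClass v
      other  : v ≢ R₁ → v ≢ R₂ → v ≢ P₁ → v ≢ P₂ → VertexClass v

    vertexClass : ∀ v → VertexClass v
    vertexClass v with Fin._≟_ v R₁
    ... | yes e = isR₁ e
    ... | no a with Fin._≟_ v R₂
    ...   | yes e = isR₂ e
    ...   | no b with Fin._≟_ v P₁
    ...     | yes e = isP₁ e
    ...     | no c with Fin._≟_ v P₂
    ...       | yes e = isP₂ e
    ...       | no f = other a b c f

    data MergedEdge (a b : Vertex k) : Set where
      newChord : SameChord a b P₁ P₂ → MergedEdge a b
      kept : partner d a ≡ just b → a ≢ R₁ → a ≢ R₂ → a ≢ P₁ → a ≢ P₂ → b ≢ R₁ → b ≢ R₂ → b ≢ P₁ → b ≢ P₂ → MergedEdge a b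
      joined : x ≢ P₂ → SameChord a b x y → MergedEdge a b

    partner-merged-other : ∀ a → a ≢ R₁ → a ≢ R₂ → a ≢ P₁ → a ≢ P₂ → partner merged a ≡ redirect (partner d a)
    partner-merged-other a a1 a2 a3 a4 = trans (partner-merged a) (mergedPartner-other a a1 a2 a3 a4)

    merged-edge : ∀ a b → partner merged a ≡ just b → MergedEdge a b
    merged-edge a b e with vertexClass a
    ... | isR₁ r = ⊥-elim (nothing≢just (trans (sym mergedPartner-R₁) (trans (sym (partner-merged R₁)) (subst (λ z → partner merged z ≡ just b) r e))))
    ... | isR₂ r = ⊥-elim (nothing≢just (trans (sym mergedPartner-R₂) (trans (sym (partner-merged R₂)) (subst (λ z → partner merged z ≡ just b) r e))))
    ... | isP₁ r = newChord (inj₁ (r , just-injective (trans (sym (subst (λ z → partner merged z ≡ just b) r e)) (trans (partner-merged P₁) mergedPartner-P₁))))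
    ... | isP₂ r = newChord (inj₂ (r , just-injective (trans (sym (subst (λ z → partner merged z ≡ just b) r e)) (trans (partner-merged P₂) mergedPartner-P₂))))
    ... | other a1 a2 a3 a4 with partner d a in eu
    ...   | nothing = ⊥-elim (nothing≢just (trans (sym (trans (partner-merged-other a a1 a2 a3 a4) (cong redirect eu))) e))
    ...   | just u with vertexClass u
    ...     | isR₁ r = ⊥-elim (a2 (sym (just-injective (trans (sym eR) (proj₂ (inv a R₁ (trans eu (cong just r))))))))
    ...     | isR₂ r = ⊥-elim (a1 (sym (just-injective (trans (sym eR′) (proj₂ (inv a R₂ (trans eu (cong just r))))))))
    ...     | isP₁ r = joined x≢P₂ (inj₁ (ax , by))
      where
      eu₁ : partner d a ≡ just P₁
      eu₁ = trans eu (cong just r)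
      ax : a ≡ x
      ax = just-injective (trans (sym (proj₂ (inv a P₁ eu₁))) ex)
      by : b ≡ y
      by = just-injective (trans (sym e) (trans (partner-merged-other a a1 a2 a3 a4) (trans (cong redirect eu₁) redirect-P₁)))
      x≢P₂ : x ≢ P₂
      x≢P₂ xp = a4 (trans ax xp)
    ...     | isP₂ r = joined x≢P₂ (inj₂ (ay , bx))
      where
      eu₁ : partner d a ≡ just P₂
      eu₁ = trans eu (cong just r)
      ay : a ≡ y
      ay = just-injective (trans (sym (proj₂ (inv a P₂ eu₁))) ey)
      bx : b ≡ x
      bx = just-injective (trans (sym e) (trans (partner-merged-other a a1 a2 a3 a4) (trans (cong redirect eu₁) redirect-P₂)))
      x≢P₂ : x ≢ P₂
      x≢P₂ xp = a3 (trans ay (just-injective (trans (sym ey) (proj₂ (inv P₁ P₂ (trans ex (cong just xp)))))))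
    ...     | other u1 u2 u3 u4 = kept (trans eu (cong just ub)) a1 a2 a3 a4 (λ z → u1 (trans ub z)) (λ z → u2 (trans ub z)) (λ z → u3 (trans ub z)) (λ z → u4 (trans ub z))
      where
      ub : u ≡ b
      ub = just-injective (trans (sym (trans (partner-merged-other a a1 a2 a3 a4) (trans (cong redirect eu) (redirect-other u u3 u4)))) e)

    y≢P₁ : x ≢ P₂ → y ≢ P₁
    y≢P₁ xp yp = xp (just-injective (trans (sym ex) (proj₂ (inv P₂ P₁ (trans ey (cong just yp))))))

    merged-involution : Involution merged
    merged-involution a b e with merged-edge a b e
    ... | newChord (inj₁ (refl , refl)) = P₁≢P₂ , trans (partner-merged P₂) mergedPartner-P₂
    ... | newChord (inj₂ (refl , refl)) = (λ z → P₁≢P₂ (sym z)) , trans (partner-merged P₁) mergedPartner-P₁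
    ... | kept ed a1 a2 a3 a4 b1 b2 b3 b4 = proj₁ (inv a b ed) , trans (partner-merged-other b b1 b2 b3 b4) (trans (cong redirect (proj₂ (inv a b ed))) (redirect-other a a3 a4))
    ... | joined x≢P₂ (inj₁ (refl , refl)) = x≢y , trans (partner-merged-other y y≢R₁ y≢R₂ (y≢P₁ x≢P₂) y≢P₂) (trans (cong redirect ey′) redirect-P₂)
    ... | joined x≢P₂ (inj₂ (refl , refl)) = (λ z → x≢y (sym z)) , trans (partner-merged-other x x≢R₁ x≢R₂ x≢P₁ x≢P₂) (trans (cong redirect ex′) redirect-P₁)

    OutsideSpan : Vertex k → Set
    OutsideSpan z = Outside (pos {k} P₁) (pos {k} P₂) (pos {k} z)

    span-ends : ∀ {a b} → OutsideSpan a → OutsideSpan b → insideChord a b P₁ ≡ insideChord a b P₂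
    span-ends {a} {b} ga gb = inside-ends (pos {k} P₁) (pos {k} P₂) (pos {k} a) (pos {k} b) ga gb

    span-outside : ∀ {z} → OutsideSpan z → insideChord P₁ P₂ z ≡ false
    span-outside {z} g = inside-outside (pos {k} P₁) (pos {k} P₂) (pos {k} z) g

    x-outside : x ≢ P₂ → OutsideSpan x
    x-outside x≢P₂ = out x P₁ ex′ x≢R₁ x≢R₂ x≢P₁ x≢P₂
    y-outside : x ≢ P₂ → OutsideSpan y
    y-outside x≢P₂ = out y P₂ ey′ y≢R₁ y≢R₂ (y≢P₁ x≢P₂) y≢P₂

    joined-outsideˡ : ∀ {a b} → x ≢ P₂ → SameChord a b x y → OutsideSpan a
    joined-outsideˡ x≢P₂ (inj₁ (refl , _)) = x-outside x≢P₂
    joined-outsideˡ x≢P₂ (inj₂ (refl , _)) = y-outside x≢P₂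

    joined-outsideʳ : ∀ {a b} → x ≢ P₂ → SameChord a b x y → OutsideSpan b
    joined-outsideʳ x≢P₂ (inj₁ (_ , refl)) = y-outside x≢P₂
    joined-outsideʳ x≢P₂ (inj₂ (_ , refl)) = x-outside x≢P₂

    kept-joined : ∀ {a b} → partner d a ≡ just b → OutsideSpan a → OutsideSpan b → a ≢ P₁ → b ≢ P₁ → a ≢ P₂ → b ≢ P₂ →
         insideChord a b x ≡ insideChord a b y
    kept-joined {a} {b} ed ga gb a3 b3 a4 b4 =
      trans (NonCrossing⇒insideChord d inv nc a b x P₁ ed ex′ xa xb)
        (trans (span-ends ga gb) (sym (NonCrossing⇒insideChord d inv nc a b y P₂ ed ey′ ya yb)))
      where
      xa : x ≢ a
      xa e = b3 (just-injective (trans (sym ed) (trans (cong (partner d) (sym e)) ex′)))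
      xb : x ≢ b
      xb e = a3 (just-injective (trans (sym (proj₂ (inv a b ed))) (trans (cong (partner d) (sym e)) ex′)))
      ya : y ≢ a
      ya e = b4 (just-injective (trans (sym ed) (trans (cong (partner d) (sym e)) ey′)))
      yb : y ≢ b
      yb e = a4 (just-injective (trans (sym (proj₂ (inv a b ed))) (trans (cong (partner d) (sym e)) ey′)))

    merged-nonCrossing : NonCrossing merged
    merged-nonCrossing = NonCrossing-intro merged merged-involution h
      where
      h : ∀ a b c f → partner merged a ≡ just b → partner merged c ≡ just f → c ≢ a → c ≢ b → insideChord a b c ≡ insideChord a b f
      h a b c f ea ec′ nca ncb with merged-edge a b ea | merged-edge c f ec′
      ... | newChord pa | newChord pc = ⊥-elim (SameChord-unique pa pc nca ncb)
      ... | newChord (inj₁ (refl , refl)) | kept ed c1 c2 c3 c4 from1-fuel f2 f3 f4 =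
            trans (span-outside (out c f ed c1 c2 c3 c4)) (sym (span-outside (out f c (proj₂ (inv c f ed)) from1-fuel f2 f3 f4)))
      ... | newChord (inj₂ (refl , refl)) | kept ed c1 c2 c3 c4 from1-fuel f2 f3 f4 =
            trans (insideChord-comm P₂ P₁ c) (trans (span-outside (out c f ed c1 c2 c3 c4)) (sym (trans (insideChord-comm P₂ P₁ f) (span-outside (out f c (proj₂ (inv c f ed)) from1-fuel f2 f3 f4)))))
      ... | newChord (inj₁ (refl , refl)) | joined x≢P₂ o =
            SameChord-orient (insideChord P₁ P₂) o (trans (span-outside (x-outside x≢P₂)) (sym (span-outside (y-outside x≢P₂))))
      ... | newChord (inj₂ (refl , refl)) | joined x≢P₂ o =
            SameChord-orient (insideChord P₂ P₁) o (trans (insideChord-comm P₂ P₁ x) (trans (span-outside (x-outside x≢P₂)) (sym (trans (insideChord-comm P₂ P₁ y) (span-outside (y-outside x≢P₂))))))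
      ... | kept ed a1 a2 a3 a4 b1 b2 b3 b4 | newChord (inj₁ (refl , refl)) =
            span-ends (out a b ed a1 a2 a3 a4) (out b a (proj₂ (inv a b ed)) b1 b2 b3 b4)
      ... | kept ed a1 a2 a3 a4 b1 b2 b3 b4 | newChord (inj₂ (refl , refl)) =
            sym (span-ends (out a b ed a1 a2 a3 a4) (out b a (proj₂ (inv a b ed)) b1 b2 b3 b4))
      ... | kept ed _ _ _ _ _ _ _ _ | kept ed′ _ _ _ _ _ _ _ _ = NonCrossing⇒insideChord d inv nc a b c f ed ed′ nca ncb
      ... | kept ed a1 a2 a3 a4 b1 b2 b3 b4 | joined x≢P₂ o =
            SameChord-orient (insideChord a b) o (kept-joined ed (out a b ed a1 a2 a3 a4) (out b a (proj₂ (inv a b ed)) b1 b2 b3 b4) a3 b3 a4 b4)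
      ... | joined x≢P₂ o | newChord (inj₁ (refl , refl)) = span-ends (joined-outsideˡ x≢P₂ o) (joined-outsideʳ x≢P₂ o)
      ... | joined x≢P₂ o | newChord (inj₂ (refl , refl)) = sym (span-ends (joined-outsideˡ x≢P₂ o) (joined-outsideʳ x≢P₂ o))
      ... | joined x≢P₂ o | kept ed c1 c2 c3 c4 from1-fuel f2 f3 f4 =
            inside-symmetric (pos-≢ (proj₁ (merged-involution c f ec′))) (pos-≢ (proj₁ (merged-involution a b ea))) (pos-≢ (≢-sym nca)) (pos-≢ (≢-sym (proj₁ (other-ends-≢ merged merged-involution ea ec′ nca ncb))))
                       (pos-≢ (≢-sym ncb)) (pos-≢ (≢-sym (proj₂ (other-ends-≢ merged merged-involution ea ec′ nca ncb))))
                       (SameChord-orient (insideChord c f) o (kept-joined ed (out c f ed c1 c2 c3 c4) (out f c (proj₂ (inv c f ed)) from1-fuel f2 f3 f4) c3 f3 c4 f4))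
      ... | joined _ pa | joined _ pc = ⊥-elim (SameChord-unique pa pc nca ncb)

    merged-isMotzkin : T (isMotzkin merged)
    merged-isMotzkin = isMotzkin-intro merged merged-involution merged-nonCrossing

    redirect-is-just : ∀ m → is-just (redirect m) ≡ true → is-just m ≡ true
    redirect-is-just (just w) _ = refl

    size-merged : size merged < size d
    size-merged = count-mono-< fewer R₁ (cong is-just (trans (partner-merged R₁) mergedPartner-R₁)) (is-just-just eR)
      where
      fewer : ∀ v → is-just (partner merged v) ≡ true → is-just (partner d v) ≡ true
      fewer v h with vertexClass v
      ... | isR₁ r = ⊥-elim (true≢false (trans (sym h) (cong is-just (trans (cong (partner merged) r) (trans (partner-merged R₁) mergedPartner-R₁)))))
      ... | isR₂ r = ⊥-elim (true≢false (trans (sym h) (cong is-just (trans (cong (partner merged) r) (trans (partner-merged R₂) mergedPartner-R₂)))))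
      ... | isP₁ r = trans (cong (λ z → is-just (partner d z)) r) (is-just-just ex)
      ... | isP₂ r = trans (cong (λ z → is-just (partner d z)) r) (is-just-just ey)
      ... | other a1 a2 a3 a4 = redirect-is-just (partner d v) (trans (cong is-just (sym (partner-merged-other v a1 a2 a3 a4))) h)

  module Span (p q : Fin k) (p<q : toℕ p < toℕ q) where

    p≢q : p ≢ q
    p≢q = toℕ-<⇒≢ p<q

    Outer : Fin k → Set
    Outer j = (toℕ j < toℕ p) ⊎ (toℕ q < toℕ j)

    data Column (j : Fin k) : Set where
      atP   : j ≡ p → Column j
      atQ   : j ≡ q → Column j
      inner : toℕ p < toℕ j → toℕ j < toℕ q → Column j
      outer : j ≢ p → j ≢ q → Outer j → Column j

    column : ∀ j → Column j
    column j with <-cmp (toℕ j) (toℕ p)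
    ... | tri< j<p _ _ = outer (toℕ-<⇒≢ j<p) (toℕ-<⇒≢ (<-trans j<p p<q)) (inj₁ j<p)
    ... | tri≈ _ j≡p _ = atP (toℕ-injective j≡p)
    ... | tri> _ _ p<j with <-cmp (toℕ j) (toℕ q)
    ...   | tri< j<q _ _ = inner p<j j<q
    ...   | tri≈ _ j≡q _ = atQ (toℕ-injective j≡q)
    ...   | tri> _ _ q<j = outer (≢-sym (toℕ-<⇒≢ p<j)) (≢-sym (toℕ-<⇒≢ q<j)) (inj₂ q<j)

    strictlyBetween : Fin k → Bool
    strictlyBetween j = (toℕ p <ᵇ toℕ j) ∧ (toℕ j <ᵇ toℕ q)

    strictlyBetween-inner : ∀ j → toℕ p < toℕ j → toℕ j < toℕ q → strictlyBetween j ≡ true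
    strictlyBetween-inner j p<j j<q rewrite <ᵇ-true p<j | <ᵇ-true j<q = refl

    strictlyBetween-outer : ∀ j → Outer j → strictlyBetween j ≡ false
    strictlyBetween-outer j (inj₁ j<p) rewrite <ᵇ-false {toℕ p} {toℕ j} (<⇒≤ j<p) = refl
    strictlyBetween-outer j (inj₂ q<j) rewrite <ᵇ-false {toℕ j} {toℕ q} (<⇒≤ q<j) = ∧-zeroʳ _

    capCupTop capCupBot : Fin k → Maybe (Vertex k)
    capCupTop j = if eqF j p then just (top q) else if eqF j q then just (top p) else if strictlyBetween j then nothing else just (bot j)
    capCupBot j = if eqF j p then just (bot q) else if eqF j q then just (bot p) else if strictlyBetween j then nothing else just (top j)

    capCup : Raw k
    capCup = rawByRow capCupTop capCupBot

    capCup-top-p : partner capCup (top p) ≡ just (top q)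
    capCup-top-p rewrite partner-rawByRow-top capCupTop capCupBot p | eqF-refl p = refl

    capCup-top-q : partner capCup (top q) ≡ just (top p)
    capCup-top-q rewrite partner-rawByRow-top capCupTop capCupBot q | eqF-≢ (≢-sym p≢q) | eqF-refl q = refl

    capCup-top-inner : ∀ j → toℕ p < toℕ j → toℕ j < toℕ q → partner capCup (top j) ≡ nothing
    capCup-top-inner j p<j j<q rewrite partner-rawByRow-top capCupTop capCupBot j
      | eqF-≢ (≢-sym (toℕ-<⇒≢ p<j)) | eqF-≢ (toℕ-<⇒≢ j<q) | strictlyBetween-inner j p<j j<q = refl

    capCup-top-outer : ∀ j → j ≢ p → j ≢ q → Outer j → partner capCup (top j) ≡ just (bot j)
    capCup-top-outer j j≢p j≢q o rewrite partner-rawByRow-top capCupTop capCupBot j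
      | eqF-≢ j≢p | eqF-≢ j≢q | strictlyBetween-outer j o = refl

    capCup-bot-p : partner capCup (bot p) ≡ just (bot q)
    capCup-bot-p rewrite partner-rawByRow-bot capCupTop capCupBot p | eqF-refl p = refl

    capCup-bot-q : partner capCup (bot q) ≡ just (bot p)
    capCup-bot-q rewrite partner-rawByRow-bot capCupTop capCupBot q | eqF-≢ (≢-sym p≢q) | eqF-refl q = refl

    capCup-bot-inner : ∀ j → toℕ p < toℕ j → toℕ j < toℕ q → partner capCup (bot j) ≡ nothing
    capCup-bot-inner j p<j j<q rewrite partner-rawByRow-bot capCupTop capCupBot j
      | eqF-≢ (≢-sym (toℕ-<⇒≢ p<j)) | eqF-≢ (toℕ-<⇒≢ j<q) | strictlyBetween-inner j p<j j<q = refl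

    capCup-bot-outer : ∀ j → j ≢ p → j ≢ q → Outer j → partner capCup (bot j) ≡ just (top j)
    capCup-bot-outer j j≢p j≢q o rewrite partner-rawByRow-bot capCupTop capCupBot j
      | eqF-≢ j≢p | eqF-≢ j≢q | strictlyBetween-outer j o = refl

    data CapCupEdge (a b : Vertex k) : Set where
      isCap      : SameChord a b (top p) (top q) → CapCupEdge a b
      isCup      : SameChord a b (bot p) (bot q) → CapCupEdge a b
      isVertical : ∀ j → Outer j → j ≢ p → j ≢ q → Vertical j a b → CapCupEdge a b

    capCup-edge : ∀ a b → partner capCup a ≡ just b → CapCupEdge a b
    capCup-edge a b e with view {k} a
    ... | vtop j with column j
    ...   | atP refl = isCap (inj₁ (refl , just-injective (trans (sym e) capCup-top-p)))
    ...   | atQ refl = isCap (inj₂ (refl , just-injective (trans (sym e) capCup-top-q)))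
    ...   | inner p<j j<q = ⊥-elim (nothing≢just (trans (sym (capCup-top-inner j p<j j<q)) e))
    ...   | outer j≢p j≢q o = isVertical j o j≢p j≢q (inj₁ (refl , just-injective (trans (sym e) (capCup-top-outer j j≢p j≢q o))))
    capCup-edge a b e | vbot j with column j
    ...   | atP refl = isCup (inj₁ (refl , just-injective (trans (sym e) capCup-bot-p)))
    ...   | atQ refl = isCup (inj₂ (refl , just-injective (trans (sym e) capCup-bot-q)))
    ...   | inner p<j j<q = ⊥-elim (nothing≢just (trans (sym (capCup-bot-inner j p<j j<q)) e))
    ...   | outer j≢p j≢q o = isVertical j o j≢p j≢q (inj₂ (refl , just-injective (trans (sym e) (capCup-bot-outer j j≢p j≢q o))))

    capCup-involution : Involution capCup
    capCup-involution a b e with capCup-edge a b e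
    ... | isCap (inj₁ (refl , refl)) = top-≢ p≢q , capCup-top-q
    ... | isCap (inj₂ (refl , refl)) = top-≢ (≢-sym p≢q) , capCup-top-p
    ... | isCup (inj₁ (refl , refl)) = bot-≢ p≢q , capCup-bot-q
    ... | isCup (inj₂ (refl , refl)) = bot-≢ (≢-sym p≢q) , capCup-bot-p
    ... | isVertical j o j≢p j≢q (inj₁ (refl , refl)) = top≢bot , capCup-bot-outer j j≢p j≢q o
    ... | isVertical j o j≢p j≢q (inj₂ (refl , refl)) = bot≢top , capCup-top-outer j j≢p j≢q o

    outer-compare : ∀ i → Outer i → (toℕ i <ᵇ toℕ p) ≡ (toℕ i <ᵇ toℕ q)
    outer-compare i (inj₁ i<p) rewrite <ᵇ-true i<p | <ᵇ-true (<-trans i<p p<q) = refl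
    outer-compare i (inj₂ q<i) rewrite <ᵇ-false {toℕ i} {toℕ p} (<⇒≤ (<-trans p<q q<i)) | <ᵇ-false {toℕ i} {toℕ q} (<⇒≤ q<i) = refl

    capCup-nonCrossing : NonCrossing capCup
    capCup-nonCrossing = NonCrossing-intro capCup capCup-involution separates-not
      where
      separates-not : ∀ a b c f → partner capCup a ≡ just b → partner capCup c ≡ just f → c ≢ a → c ≢ b →
                      insideChord a b c ≡ insideChord a b f
      separates-not a b c f ea ec c≢a c≢b with capCup-edge a b ea | capCup-edge c f ec
      ... | isCap o | isCap o′ = ⊥-elim (SameChord-unique o o′ c≢a c≢b)
      ... | isCup o | isCup o′ = ⊥-elim (SameChord-unique o o′ c≢a c≢b)
      ... | isCap o | isCup o′ =
        insideChord-chords o o′ (trans (insideChord-cap-bot p q p p<q) (sym (insideChord-cap-bot p q q p<q)))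
      ... | isCap o | isVertical j oj _ _ v =
        insideChord-chords o v (trans (insideChord-cap-top p q j p<q) (trans (strictlyBetween-outer j oj) (sym (insideChord-cap-bot p q j p<q))))
      ... | isCup o | isCap o′ =
        insideChord-chords o o′ (trans (insideChord-cup-top p q p p<q) (sym (insideChord-cup-top p q q p<q)))
      ... | isCup o | isVertical j oj _ _ v =
        insideChord-chords o v (trans (insideChord-cup-top p q j p<q)
          (sym (trans (insideChord-cup-bot p q j p<q) (trans (∧-comm (toℕ j <ᵇ toℕ q) (toℕ p <ᵇ toℕ j)) (strictlyBetween-outer j oj)))))
      ... | isVertical i oi _ _ v | isCap o′ =
        insideChord-chords v o′ (trans (insideChord-through-top i i p) (trans (outer-compare i oi) (sym (insideChord-through-top i i q))))
      ... | isVertical i oi _ _ v | isCup o′ =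
        insideChord-chords v o′ (trans (insideChord-through-bot i i p) (trans (outer-compare i oi) (sym (insideChord-through-bot i i q))))
      ... | isVertical _ _ _ _ v | isVertical _ _ _ _ w = vertical-separates-not v w

    capCup-isMotzkin : T (isMotzkin capCup)
    capCup-isMotzkin = isMotzkin-intro capCup capCup-involution capCup-nonCrossing

  -- For an innermost cap p–q of d, whose bottom vertices p′ and q′ are joined to x and y:
  -- d = capCup · rest without closed loops, and rest · capCup is d with the cap traded for the cup p′–q′ and the
  -- strand x–y, one edge fewer.
  module CapFactorisation (d : Raw k) (valid : T (isMotzkin d)) (p q : Fin k) (p<q : toℕ p < toℕ q)
    (capped : partner d (top p) ≡ just (top q))
    (empty-top : ∀ (j : Fin k) → toℕ p < toℕ j → toℕ j < toℕ q → partner d (top j) ≡ nothing)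
    (empty-bot : ∀ (j : Fin k) → toℕ p < toℕ j → toℕ j < toℕ q → partner d (bot j) ≡ nothing)
    (x y : Vertex k) (ex : partner d (bot p) ≡ just x) (ey : partner d (bot q) ≡ just y)
    where
    open Span p q p<q public

    inv : Involution d
    inv = isMotzkin⇒Involution d valid

    capped′ : partner d (top q) ≡ just (top p)
    capped′ = proj₂ (inv (top p) (top q) capped)

    rest : Raw k
    rest = dropEdge d (top p)

    rest-agrees : ∀ v → v ≢ top p → v ≢ top q → partner rest v ≡ partner d v
    rest-agrees v a b with partner d v in e
    ... | nothing = partner-dropEdge-via d (top p) v a e
    ... | just w = dropEdge-keeps d (top p) v w a e wp
      where wp : w ≢ top p
            wp r = b (just-injective (trans (sym (proj₂ (inv v w e))) (trans (cong (partner d) r) capped)))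

    rest-top-p : partner rest (top p) ≡ nothing
    rest-top-p = partner-dropEdge-self d (top p)
    rest-top-q : partner rest (top q) ≡ nothing
    rest-top-q = trans (partner-dropEdge-via d (top p) (top q) (top-≢ (≢-sym p≢q)) capped′) (unlessTo-self (top p))

    only-q-to-p : ∀ v → v ≢ top q → partner d v ≢ just (top p)
    only-q-to-p v vq e = vq (just-injective (trans (sym (proj₂ (inv v (top p) e))) capped))
    only-p-to-q : ∀ v → v ≢ top p → partner d v ≢ just (top q)
    only-p-to-q v vp e = vp (just-injective (trans (sym (proj₂ (inv v (top q) e))) capped′))
    none-to-inner-top : ∀ v (j : Fin k) → toℕ p < toℕ j → toℕ j < toℕ q → partner d v ≢ just (top j)
    none-to-inner-top v j a b e = nothing≢just (trans (sym (empty-top j a b)) (proj₂ (inv v (top j) e)))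
    none-to-inner-bot : ∀ v (j : Fin k) → toℕ p < toℕ j → toℕ j < toℕ q → partner d v ≢ just (bot j)
    none-to-inner-bot v j a b e = nothing≢just (trans (sym (empty-bot j a b)) (proj₂ (inv v (bot j) e)))

    noMiddleLoop : Walk.NoMiddleLoop capCup rest
    noMiddleLoop j j′ j″ e₁ e₂ with column j
    ... | atP refl = nothing≢just (trans (sym rest-top-q) (trans (cong (λ z → partner rest (top z)) (bot-injective {k} (just-injective (trans (sym capCup-bot-p) e₁)))) e₂))
    ... | atQ refl = nothing≢just (trans (sym rest-top-p) (trans (cong (λ z → partner rest (top z)) (bot-injective {k} (just-injective (trans (sym capCup-bot-q) e₁)))) e₂))
    ... | inner a b = nothing≢just (trans (sym (capCup-bot-inner j a b)) e₁)
    ... | outer a b o = top≢bot (just-injective (trans (sym (capCup-bot-outer j a b o)) e₁))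

    factor : compose capCup rest ≡ d
    factor = raw-tabulate-partner d same
      where
      open Walk capCup rest
      same : ∀ v → outPartner v ≡ partner d v
      same v with view {k} v
      ... | vtop j with column j
      ...   | atP refl = trans (out-top-top p q capCup-top-p) (sym capped)
      ...   | atQ refl = trans (out-top-top q p capCup-top-q) (sym capped′)
      ...   | inner a b = trans (out-top-isolated j (capCup-top-inner j a b)) (sym (empty-top j a b))
      ...   | outer a b o with partnerView (partner d (top j))
      ...     | isolated e = trans (out-top-bot j j (capCup-top-outer j a b o)) (trans (from2-isolated fuel′ j (trans (rest-agrees (top j) (top-≢ a) (top-≢ b)) e)) (sym e))
      ...     | toBot u e = trans (out-top-bot j j (capCup-top-outer j a b o)) (trans (from2-bot fuel′ j u (trans (rest-agrees (top j) (top-≢ a) (top-≢ b)) e)) (sym e))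
      ...     | toTop i e with column i
      ...       | atP refl = ⊥-elim (only-q-to-p (top j) (top-≢ b) e)
      ...       | atQ refl = ⊥-elim (only-p-to-q (top j) (top-≢ a) e)
      ...       | inner a′ b′ = ⊥-elim (none-to-inner-top (top j) i a′ b′ e)
      ...       | outer a′ b′ o′ = trans (out-top-bot j j (capCup-top-outer j a b o)) (trans (from2-top fuel′ j i (trans (rest-agrees (top j) (top-≢ a) (top-≢ b)) e))
                                    (trans (from1-top (k + k) i i (capCup-bot-outer i a′ b′ o′)) (sym e)))
      same v | vbot u with partnerView (partner d (bot u))
      ...   | isolated e = trans (out-bot-isolated u (trans (rest-agrees (bot u) bot≢top bot≢top) e)) (sym e)
      ...   | toBot u′ e = trans (out-bot-bot u u′ (trans (rest-agrees (bot u) bot≢top bot≢top) e)) (sym e)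
      ...   | toTop i e with column i
      ...     | atP refl = ⊥-elim (only-q-to-p (bot u) bot≢top e)
      ...     | atQ refl = ⊥-elim (only-p-to-q (bot u) bot≢top e)
      ...     | inner a′ b′ = ⊥-elim (none-to-inner-top (bot u) i a′ b′ e)
      ...     | outer a′ b′ o′ = trans (out-bot-top u i (trans (rest-agrees (bot u) bot≢top bot≢top) e)) (trans (from1-top fuel′ i i (capCup-bot-outer i a′ b′ o′)) (sym e))

    outside-span : ∀ z w → partner d z ≡ just w → z ≢ top p → z ≢ top q → z ≢ bot p → z ≢ bot q →
             Outside (pos {k} (bot p)) (pos {k} (bot q)) (pos {k} z)
    outside-span z w e a b c f with view {k} z
    ... | vtop t rewrite minℕ-> (pos-bot<pos-bot p q p<q) = inj₁ (pos-top<pos-bot t q)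
    ... | vbot u with column u
    ...   | atP refl = ⊥-elim (c refl)
    ...   | atQ refl = ⊥-elim (f refl)
    ...   | inner a′ b′ = ⊥-elim (nothing≢just (trans (sym (empty-bot u a′ b′)) e))
    ...   | outer _ _ (inj₁ up) rewrite maxℕ-> (pos-bot<pos-bot p q p<q) = inj₂ (pos-bot<pos-bot u p up)
    ...   | outer _ _ (inj₂ qu) rewrite minℕ-> (pos-bot<pos-bot p q p<q) = inj₁ (pos-bot<pos-bot q u qu)

    module Merged = Merge d valid (bot p) (bot q) (top p) (top q) x y (bot-≢ p≢q) capped
                  bot≢top bot≢top bot≢top bot≢top ex ey outside-span

    ex′ : partner d x ≡ just (bot p)
    ex′ = proj₂ (inv (bot p) x ex)
    ey′ : partner d y ≡ just (bot q)
    ey′ = proj₂ (inv (bot q) y ey)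

    y-outer : x ≢ bot q → ∀ j → y ≡ bot j → (j ≢ p) × (j ≢ q) × Outer j
    y-outer xq j r with column j
    ... | atP r′ = ⊥-elim (xq (just-injective (trans (sym ex) (proj₂ (inv (bot q) (bot p) (trans ey (trans (cong just r) (cong (λ z → just (bot z)) r′))))))))
    ... | atQ r′ = ⊥-elim (proj₁ (inv (bot q) y ey) (sym (trans r (cong bot r′))))
    ... | inner a b = ⊥-elim (none-to-inner-bot (bot q) j a b (trans ey (cong just r)))
    ... | outer a b o = a , b , o

    x-outer : y ≢ bot p → ∀ j → x ≡ bot j → (j ≢ p) × (j ≢ q) × Outer j
    x-outer yp j r with column j
    ... | atP r′ = ⊥-elim (proj₁ (inv (bot p) x ex) (sym (trans r (cong bot r′))))
    ... | atQ r′ = ⊥-elim (yp (just-injective (trans (sym ey) (proj₂ (inv (bot p) (bot q) (trans ex (trans (cong just r) (cong (λ z → just (bot z)) r′))))))))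
    ... | inner a b = ⊥-elim (none-to-inner-bot (bot p) j a b (trans ex (cong just r)))
    ... | outer a b o = a , b , o

    rest-bot-q : partner rest (bot q) ≡ just y
    rest-bot-q = trans (rest-agrees (bot q) bot≢top bot≢top) ey
    rest-bot-p : partner rest (bot p) ≡ just x
    rest-bot-p = trans (rest-agrees (bot p) bot≢top bot≢top) ex

    module _ where
      open Walk rest capCup

      walk-from-q : x ≢ bot q → ∀ f → from1 (suc (suc f)) q ≡ just y
      walk-from-q xq f with view {k} y | rest-bot-q | y-outer xq
      ... | vtop t | e | _ = from1-top (suc f) q t e
      ... | vbot j | e | yo with yo j refl
      ...   | a , b , o = trans (from1-bot (suc f) q j e) (from2-bot f j j (capCup-top-outer j a b o))

      walk-from-p : y ≢ bot p → ∀ f → from1 (suc (suc f)) p ≡ just x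
      walk-from-p yp f with view {k} x | rest-bot-p | x-outer yp
      ... | vtop t | e | _ = from1-top (suc f) p t e
      ... | vbot j | e | xo with xo j refl
      ...   | a , b , o = trans (from1-bot (suc f) p j e) (from2-bot f j j (capCup-top-outer j a b o))

    x≢q-via : ∀ v → partner d v ≡ just (bot p) → v ≢ bot q → x ≢ bot q
    x≢q-via v e vq xq = vq (trans (sym (just-injective (trans (sym ex) (proj₂ (inv v (bot p) e))))) xq)
    y≢p-via : ∀ v → partner d v ≡ just (bot q) → v ≢ bot p → y ≢ bot p
    y≢p-via v e vp yp = vp (trans (sym (just-injective (trans (sym ey) (proj₂ (inv v (bot q) e))))) yp)

    spare : ℕ
    spare = proj₁ (fuel-spare p)
    fuel≡ : k + k ≡ suc (suc spare)
    fuel≡ = proj₂ (fuel-spare p)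

    swapped : compose rest capCup ≡ Merged.merged
    swapped = raw-tabulate-cong same
      where
      open Walk rest capCup
      redirect-to-y : ∀ v {j} → partner d v ≡ just (bot j) → j ≡ p → Merged.redirect (partner d v) ≡ just y
      redirect-to-y v e r = trans (cong Merged.redirect e) (trans (cong (λ z → Merged.redirect (just (bot z))) r) Merged.redirect-P₁)
      redirect-to-x : ∀ v {j} → partner d v ≡ just (bot j) → j ≡ q → Merged.redirect (partner d v) ≡ just x
      redirect-to-x v e r = trans (cong Merged.redirect e) (trans (cong (λ z → Merged.redirect (just (bot z))) r) Merged.redirect-P₂)
      capCup-to-p : ∀ {j} → j ≡ p → partner capCup (top j) ≡ just (top q)
      capCup-to-p r = trans (cong (λ z → partner capCup (top z)) r) capCup-top-p
      capCup-to-q : ∀ {j} → j ≡ q → partner capCup (top j) ≡ just (top p)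
      capCup-to-q r = trans (cong (λ z → partner capCup (top z)) r) capCup-top-q
      to-p : ∀ v {j} → partner d v ≡ just (bot j) → j ≡ p → partner d v ≡ just (bot p)
      to-p v e r = trans e (cong (λ z → just (bot z)) r)
      to-q : ∀ v {j} → partner d v ≡ just (bot j) → j ≡ q → partner d v ≡ just (bot q)
      to-q v e r = trans e (cong (λ z → just (bot z)) r)
      from1-fuel : ∀ j → from1 fuel′ j ≡ from1 (suc (suc (suc spare))) j
      from1-fuel j = cong (λ z → from1 (suc z) j) fuel≡
      same : ∀ v → outPartner v ≡ Merged.mergedPartner v
      same-top : ∀ i → i ≢ p → i ≢ q → outPartner (top i) ≡ Merged.mergedPartner (top i)
      same-top i a b rewrite Merged.mergedPartner-other (top i) (top-≢ a) (top-≢ b) top≢bot top≢bot with partnerView (partner d (top i))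
      ... | isolated e = trans (out-top-isolated i (trans (rest-agrees (top i) (top-≢ a) (top-≢ b)) e)) (sym (cong Merged.redirect e))
      ... | toTop i′ e = trans (out-top-top i i′ (trans (rest-agrees (top i) (top-≢ a) (top-≢ b)) e)) (sym (trans (cong Merged.redirect e) (Merged.redirect-other (top i′) top≢bot top≢bot)))
      ... | toBot j e with column j
      ...   | atP r = trans (out-top-bot i j (trans (rest-agrees (top i) (top-≢ a) (top-≢ b)) e))
                       (trans (from2-top fuel′ j q (capCup-to-p r)) (trans (from1-fuel q) (trans (walk-from-q (x≢q-via (top i) (to-p (top i) e r) top≢bot) (suc spare)) (sym (redirect-to-y (top i) e r)))))
      ...   | atQ r = trans (out-top-bot i j (trans (rest-agrees (top i) (top-≢ a) (top-≢ b)) e))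
                       (trans (from2-top fuel′ j p (capCup-to-q r)) (trans (from1-fuel p) (trans (walk-from-p (y≢p-via (top i) (to-q (top i) e r) top≢bot) (suc spare)) (sym (redirect-to-x (top i) e r)))))
      ...   | inner a′ b′ = ⊥-elim (none-to-inner-bot (top i) j a′ b′ e)
      ...   | outer a′ b′ o′ = trans (out-top-bot i j (trans (rest-agrees (top i) (top-≢ a) (top-≢ b)) e))
                       (trans (from2-bot fuel′ j j (capCup-top-outer j a′ b′ o′)) (sym (trans (cong Merged.redirect e) (Merged.redirect-other (bot j) (bot-≢ a′) (bot-≢ b′)))))
      same v with view {k} v
      ... | vtop i with column i
      ...   | atP r = trans (out-top-isolated i (trans (cong (λ z → partner rest (top z)) r) rest-top-p)) (sym (trans (cong (λ z → Merged.mergedPartner (top z)) r) Merged.mergedPartner-R₁))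
      ...   | atQ r = trans (out-top-isolated i (trans (cong (λ z → partner rest (top z)) r) rest-top-q)) (sym (trans (cong (λ z → Merged.mergedPartner (top z)) r) Merged.mergedPartner-R₂))
      ...   | inner a b = same-top i (≢-sym (toℕ-<⇒≢ a)) (toℕ-<⇒≢ b)
      ...   | outer a b _ = same-top i a b
      same v | vbot u with column u
      ...   | atP r = trans (out-bot-bot u q (trans (cong (λ z → partner capCup (bot z)) r) capCup-bot-p)) (sym (trans (cong (λ z → Merged.mergedPartner (bot z)) r) Merged.mergedPartner-P₁))
      ...   | atQ r = trans (out-bot-bot u p (trans (cong (λ z → partner capCup (bot z)) r) capCup-bot-q)) (sym (trans (cong (λ z → Merged.mergedPartner (bot z)) r) Merged.mergedPartner-P₂))
      ...   | inner a b = trans (out-bot-isolated u (capCup-bot-inner u a b)) (sym (trans (Merged.mergedPartner-other (bot u) bot≢top bot≢top (bot-≢ (≢-sym (toℕ-<⇒≢ a))) (bot-≢ (toℕ-<⇒≢ b))) (cong Merged.redirect (empty-bot u a b))))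
      ...   | outer a b o rewrite Merged.mergedPartner-other (bot u) bot≢top bot≢top (bot-≢ a) (bot-≢ b) with partnerView (partner d (bot u))
      ...     | isolated e = trans (out-bot-top u u (capCup-bot-outer u a b o)) (trans (from1-isolated fuel′ u (trans (rest-agrees (bot u) bot≢top bot≢top) e)) (sym (cong Merged.redirect e)))
      ...     | toTop i e = trans (out-bot-top u u (capCup-bot-outer u a b o)) (trans (from1-top fuel′ u i (trans (rest-agrees (bot u) bot≢top bot≢top) e))
                           (sym (trans (cong Merged.redirect e) (Merged.redirect-other (top i) top≢bot top≢bot))))
      ...     | toBot j e with column j
      ...       | atP r = trans (out-bot-top u u (capCup-bot-outer u a b o)) (trans (from1-bot fuel′ u j (trans (rest-agrees (bot u) bot≢top bot≢top) e))
                           (trans (from2-top (k + k) j q (capCup-to-p r)) (trans (cong (λ z → from1 z q) fuel≡)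
                             (trans (walk-from-q (x≢q-via (bot u) (to-p (bot u) e r) (bot-≢ b)) spare) (sym (redirect-to-y (bot u) e r))))))
      ...       | atQ r = trans (out-bot-top u u (capCup-bot-outer u a b o)) (trans (from1-bot fuel′ u j (trans (rest-agrees (bot u) bot≢top bot≢top) e))
                           (trans (from2-top (k + k) j p (capCup-to-q r)) (trans (cong (λ z → from1 z p) fuel≡)
                             (trans (walk-from-p (y≢p-via (bot u) (to-q (bot u) e r) (bot-≢ a)) spare) (sym (redirect-to-x (bot u) e r))))))
      ...       | inner a′ b′ = ⊥-elim (none-to-inner-bot (bot u) j a′ b′ e)
      ...       | outer a′ b′ o′ = trans (out-bot-top u u (capCup-bot-outer u a b o)) (trans (from1-bot fuel′ u j (trans (rest-agrees (bot u) bot≢top bot≢top) e))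
                           (trans (from2-bot (k + k) j j (capCup-top-outer j a′ b′ o′)) (sym (trans (cong Merged.redirect e) (Merged.redirect-other (bot j) (bot-≢ a′) (bot-≢ b′))))))

  module CupFactorisation (d : Raw k) (valid : T (isMotzkin d)) (p q : Fin k) (p<q : toℕ p < toℕ q)
    (cupped : partner d (bot p) ≡ just (bot q))
    (empty-top : ∀ (j : Fin k) → toℕ p < toℕ j → toℕ j < toℕ q → partner d (top j) ≡ nothing)
    (empty-bot : ∀ (j : Fin k) → toℕ p < toℕ j → toℕ j < toℕ q → partner d (bot j) ≡ nothing)
    (x y : Vertex k) (ex : partner d (top p) ≡ just x) (ey : partner d (top q) ≡ just y)
    where
    open Span p q p<q public

    inv : Involution d
    inv = isMotzkin⇒Involution d valid

    cupped′ : partner d (bot q) ≡ just (bot p)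
    cupped′ = proj₂ (inv (bot p) (bot q) cupped)

    rest : Raw k
    rest = dropEdge d (bot p)

    rest-agrees : ∀ v → v ≢ bot p → v ≢ bot q → partner rest v ≡ partner d v
    rest-agrees v a b with partner d v in e
    ... | nothing = partner-dropEdge-via d (bot p) v a e
    ... | just w = dropEdge-keeps d (bot p) v w a e wp
      where wp : w ≢ bot p
            wp r = b (just-injective (trans (sym (proj₂ (inv v w e))) (trans (cong (partner d) r) cupped)))

    rest-bot-p : partner rest (bot p) ≡ nothing
    rest-bot-p = partner-dropEdge-self d (bot p)
    rest-bot-q : partner rest (bot q) ≡ nothing
    rest-bot-q = trans (partner-dropEdge-via d (bot p) (bot q) (bot-≢ (≢-sym p≢q)) cupped′) (unlessTo-self (bot p))

    only-q-to-p : ∀ v → v ≢ bot q → partner d v ≢ just (bot p)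
    only-q-to-p v vq e = vq (just-injective (trans (sym (proj₂ (inv v (bot p) e))) cupped))
    only-p-to-q : ∀ v → v ≢ bot p → partner d v ≢ just (bot q)
    only-p-to-q v vp e = vp (just-injective (trans (sym (proj₂ (inv v (bot q) e))) cupped′))
    none-to-inner-top : ∀ v (j : Fin k) → toℕ p < toℕ j → toℕ j < toℕ q → partner d v ≢ just (top j)
    none-to-inner-top v j a b e = nothing≢just (trans (sym (empty-top j a b)) (proj₂ (inv v (top j) e)))
    none-to-inner-bot : ∀ v (j : Fin k) → toℕ p < toℕ j → toℕ j < toℕ q → partner d v ≢ just (bot j)
    none-to-inner-bot v j a b e = nothing≢just (trans (sym (empty-bot j a b)) (proj₂ (inv v (bot j) e)))

    noMiddleLoop : Walk.NoMiddleLoop rest capCup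
    noMiddleLoop j j′ j″ e₁ e₂ with column j′
    ... | atP refl = proj₂ (proj₂ (dropEdge-⊆ d (bot p) (bot j) (bot j′) e₁)) refl
    ... | atQ r with dropEdge-⊆ d (bot p) (bot j) (bot j′) e₁
    ...   | ed , jn , _ = jn (just-injective (trans (sym (proj₂ (inv (bot j) (bot q) (trans ed (cong (λ z → just (bot z)) r))))) cupped′))
    noMiddleLoop j j′ j″ e₁ e₂ | inner a b = nothing≢just (trans (sym (capCup-top-inner j′ a b)) e₂)
    noMiddleLoop j j′ j″ e₁ e₂ | outer a b o = top≢bot (sym (just-injective (trans (sym (capCup-top-outer j′ a b o)) e₂)))

    factor : compose rest capCup ≡ d
    factor = raw-tabulate-partner d same
      where
      open Walk rest capCup
      same : ∀ v → outPartner v ≡ partner d v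
      same v with view {k} v
      ... | vtop i with partnerView (partner d (top i))
      ...   | isolated e = trans (out-top-isolated i (trans (rest-agrees (top i) top≢bot top≢bot) e)) (sym e)
      ...   | toTop i′ e = trans (out-top-top i i′ (trans (rest-agrees (top i) top≢bot top≢bot) e)) (sym e)
      ...   | toBot j e with column j
      ...     | atP refl = ⊥-elim (only-q-to-p (top i) top≢bot e)
      ...     | atQ refl = ⊥-elim (only-p-to-q (top i) top≢bot e)
      ...     | inner a b = ⊥-elim (none-to-inner-bot (top i) j a b e)
      ...     | outer a b o = trans (out-top-bot i j (trans (rest-agrees (top i) top≢bot top≢bot) e)) (trans (from2-bot fuel′ j j (capCup-top-outer j a b o)) (sym e))
      same v | vbot u with column u
      ...   | atP refl = trans (out-bot-bot p q capCup-bot-p) (sym cupped)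
      ...   | atQ refl = trans (out-bot-bot q p capCup-bot-q) (sym cupped′)
      ...   | inner a b = trans (out-bot-isolated u (capCup-bot-inner u a b)) (sym (empty-bot u a b))
      ...   | outer a b o with partnerView (partner d (bot u))
      ...     | isolated e = trans (out-bot-top u u (capCup-bot-outer u a b o)) (trans (from1-isolated fuel′ u (trans (rest-agrees (bot u) (bot-≢ a) (bot-≢ b)) e)) (sym e))
      ...     | toTop i e = trans (out-bot-top u u (capCup-bot-outer u a b o)) (trans (from1-top fuel′ u i (trans (rest-agrees (bot u) (bot-≢ a) (bot-≢ b)) e)) (sym e))
      ...     | toBot j e with column j
      ...       | atP refl = ⊥-elim (only-q-to-p (bot u) (bot-≢ b) e)
      ...       | atQ refl = ⊥-elim (only-p-to-q (bot u) (bot-≢ a) e)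
      ...       | inner a′ b′ = ⊥-elim (none-to-inner-bot (bot u) j a′ b′ e)
      ...       | outer a′ b′ o′ = trans (out-bot-top u u (capCup-bot-outer u a b o)) (trans (from1-bot fuel′ u j (trans (rest-agrees (bot u) (bot-≢ a) (bot-≢ b)) e))
                                  (trans (from2-bot (k + k) j j (capCup-top-outer j a′ b′ o′)) (sym e)))

    outside-span : ∀ z w → partner d z ≡ just w → z ≢ bot p → z ≢ bot q → z ≢ top p → z ≢ top q →
             Outside (pos {k} (top p)) (pos {k} (top q)) (pos {k} z)
    outside-span z w e a b c f with view {k} z
    ... | vbot u rewrite maxℕ-≤ (<⇒≤ (pos-top<pos-top p q p<q)) = inj₂ (pos-top<pos-bot q u)
    ... | vtop u with column u
    ...   | atP refl = ⊥-elim (c refl)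
    ...   | atQ refl = ⊥-elim (f refl)
    ...   | inner a′ b′ = ⊥-elim (nothing≢just (trans (sym (empty-top u a′ b′)) e))
    ...   | outer _ _ (inj₁ up) rewrite minℕ-≤ (<⇒≤ (pos-top<pos-top p q p<q)) = inj₁ (pos-top<pos-top u p up)
    ...   | outer _ _ (inj₂ qu) rewrite maxℕ-≤ (<⇒≤ (pos-top<pos-top p q p<q)) = inj₂ (pos-top<pos-top q u qu)

    module Merged = Merge d valid (top p) (top q) (bot p) (bot q) x y (top-≢ p≢q) cupped
                  top≢bot top≢bot top≢bot top≢bot ex ey outside-span

    ex′ : partner d x ≡ just (top p)
    ex′ = proj₂ (inv (top p) x ex)
    ey′ : partner d y ≡ just (top q)
    ey′ = proj₂ (inv (top q) y ey)

    y-outer : x ≢ top q → ∀ j → y ≡ top j → (j ≢ p) × (j ≢ q) × Outer j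
    y-outer xq j r with column j
    ... | atP r′ = ⊥-elim (xq (just-injective (trans (sym ex) (proj₂ (inv (top q) (top p) (trans ey (trans (cong just r) (cong (λ z → just (top z)) r′))))))))
    ... | atQ r′ = ⊥-elim (proj₁ (inv (top q) y ey) (sym (trans r (cong top r′))))
    ... | inner a b = ⊥-elim (none-to-inner-top (top q) j a b (trans ey (cong just r)))
    ... | outer a b o = a , b , o

    x-outer : y ≢ top p → ∀ j → x ≡ top j → (j ≢ p) × (j ≢ q) × Outer j
    x-outer yp j r with column j
    ... | atP r′ = ⊥-elim (proj₁ (inv (top p) x ex) (sym (trans r (cong top r′))))
    ... | atQ r′ = ⊥-elim (yp (just-injective (trans (sym ey) (proj₂ (inv (top p) (top q) (trans ex (trans (cong just r) (cong (λ z → just (top z)) r′))))))))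
    ... | inner a b = ⊥-elim (none-to-inner-top (top p) j a b (trans ex (cong just r)))
    ... | outer a b o = a , b , o

    rest-top-q : partner rest (top q) ≡ just y
    rest-top-q = trans (rest-agrees (top q) top≢bot top≢bot) ey
    rest-top-p : partner rest (top p) ≡ just x
    rest-top-p = trans (rest-agrees (top p) top≢bot top≢bot) ex

    module _ where
      open Walk capCup rest

      walk-from-q : x ≢ top q → ∀ f → from2 (suc (suc f)) q ≡ just y
      walk-from-q xq f with view {k} y | rest-top-q | y-outer xq
      ... | vbot t | e | _ = from2-bot (suc f) q t e
      ... | vtop j | e | yo with yo j refl
      ...   | a , b , o = trans (from2-top (suc f) q j e) (from1-top f j j (capCup-bot-outer j a b o))

      walk-from-p : y ≢ top p → ∀ f → from2 (suc (suc f)) p ≡ just x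
      walk-from-p yp f with view {k} x | rest-top-p | x-outer yp
      ... | vbot t | e | _ = from2-bot (suc f) p t e
      ... | vtop j | e | xo with xo j refl
      ...   | a , b , o = trans (from2-top (suc f) p j e) (from1-top f j j (capCup-bot-outer j a b o))

    x≢q-via : ∀ v → partner d v ≡ just (top p) → v ≢ top q → x ≢ top q
    x≢q-via v e vq xq = vq (trans (sym (just-injective (trans (sym ex) (proj₂ (inv v (top p) e))))) xq)
    y≢p-via : ∀ v → partner d v ≡ just (top q) → v ≢ top p → y ≢ top p
    y≢p-via v e vp yp = vp (trans (sym (just-injective (trans (sym ey) (proj₂ (inv v (top q) e))))) yp)

    spare : ℕ
    spare = proj₁ (fuel-spare p)
    fuel≡ : k + k ≡ suc (suc spare)
    fuel≡ = proj₂ (fuel-spare p)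

    swapped : compose capCup rest ≡ Merged.merged
    swapped = raw-tabulate-cong same
      where
      open Walk capCup rest
      redirect-to-y : ∀ v {j} → partner d v ≡ just (top j) → j ≡ p → Merged.redirect (partner d v) ≡ just y
      redirect-to-y v e r = trans (cong Merged.redirect e) (trans (cong (λ z → Merged.redirect (just (top z))) r) Merged.redirect-P₁)
      redirect-to-x : ∀ v {j} → partner d v ≡ just (top j) → j ≡ q → Merged.redirect (partner d v) ≡ just x
      redirect-to-x v e r = trans (cong Merged.redirect e) (trans (cong (λ z → Merged.redirect (just (top z))) r) Merged.redirect-P₂)
      capCup-to-p : ∀ {j} → j ≡ p → partner capCup (bot j) ≡ just (bot q)
      capCup-to-p r = trans (cong (λ z → partner capCup (bot z)) r) capCup-bot-p
      capCup-to-q : ∀ {j} → j ≡ q → partner capCup (bot j) ≡ just (bot p)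
      capCup-to-q r = trans (cong (λ z → partner capCup (bot z)) r) capCup-bot-q
      to-p : ∀ v {j} → partner d v ≡ just (top j) → j ≡ p → partner d v ≡ just (top p)
      to-p v e r = trans e (cong (λ z → just (top z)) r)
      to-q : ∀ v {j} → partner d v ≡ just (top j) → j ≡ q → partner d v ≡ just (top q)
      to-q v e r = trans e (cong (λ z → just (top z)) r)
      same-bot : ∀ u → u ≢ p → u ≢ q → outPartner (bot u) ≡ Merged.mergedPartner (bot u)
      same-bot u a b rewrite Merged.mergedPartner-other (bot u) (bot-≢ a) (bot-≢ b) bot≢top bot≢top with partnerView (partner d (bot u))
      ... | isolated e = trans (out-bot-isolated u (trans (rest-agrees (bot u) (bot-≢ a) (bot-≢ b)) e)) (sym (cong Merged.redirect e))
      ... | toBot u′ e = trans (out-bot-bot u u′ (trans (rest-agrees (bot u) (bot-≢ a) (bot-≢ b)) e)) (sym (trans (cong Merged.redirect e) (Merged.redirect-other (bot u′) bot≢top bot≢top)))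
      ... | toTop j e with column j
      ...   | atP r = trans (out-bot-top u j (trans (rest-agrees (bot u) (bot-≢ a) (bot-≢ b)) e))
                       (trans (from1-bot fuel′ j q (capCup-to-p r)) (trans (cong (λ z → from2 (suc z) q) fuel≡)
                         (trans (walk-from-q (x≢q-via (bot u) (to-p (bot u) e r) bot≢top) (suc spare)) (sym (redirect-to-y (bot u) e r)))))
      ...   | atQ r = trans (out-bot-top u j (trans (rest-agrees (bot u) (bot-≢ a) (bot-≢ b)) e))
                       (trans (from1-bot fuel′ j p (capCup-to-q r)) (trans (cong (λ z → from2 (suc z) p) fuel≡)
                         (trans (walk-from-p (y≢p-via (bot u) (to-q (bot u) e r) bot≢top) (suc spare)) (sym (redirect-to-x (bot u) e r)))))
      ...   | inner a′ b′ = ⊥-elim (none-to-inner-top (bot u) j a′ b′ e)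
      ...   | outer a′ b′ o′ = trans (out-bot-top u j (trans (rest-agrees (bot u) (bot-≢ a) (bot-≢ b)) e))
                       (trans (from1-top fuel′ j j (capCup-bot-outer j a′ b′ o′)) (sym (trans (cong Merged.redirect e) (Merged.redirect-other (top j) (top-≢ a′) (top-≢ b′)))))
      same : ∀ v → outPartner v ≡ Merged.mergedPartner v
      same v with view {k} v
      ... | vbot u with column u
      ...   | atP r = trans (out-bot-isolated u (trans (cong (λ z → partner rest (bot z)) r) rest-bot-p)) (sym (trans (cong (λ z → Merged.mergedPartner (bot z)) r) Merged.mergedPartner-R₁))
      ...   | atQ r = trans (out-bot-isolated u (trans (cong (λ z → partner rest (bot z)) r) rest-bot-q)) (sym (trans (cong (λ z → Merged.mergedPartner (bot z)) r) Merged.mergedPartner-R₂))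
      ...   | inner a b = same-bot u (≢-sym (toℕ-<⇒≢ a)) (toℕ-<⇒≢ b)
      ...   | outer a b _ = same-bot u a b
      same v | vtop i with column i
      ...   | atP r = trans (out-top-top i q (trans (cong (λ z → partner capCup (top z)) r) capCup-top-p)) (sym (trans (cong (λ z → Merged.mergedPartner (top z)) r) Merged.mergedPartner-P₁))
      ...   | atQ r = trans (out-top-top i p (trans (cong (λ z → partner capCup (top z)) r) capCup-top-q)) (sym (trans (cong (λ z → Merged.mergedPartner (top z)) r) Merged.mergedPartner-P₂))
      ...   | inner a b = trans (out-top-isolated i (capCup-top-inner i a b)) (sym (trans (Merged.mergedPartner-other (top i) top≢bot top≢bot (top-≢ (≢-sym (toℕ-<⇒≢ a))) (top-≢ (toℕ-<⇒≢ b))) (cong Merged.redirect (empty-top i a b))))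
      ...   | outer a b o rewrite Merged.mergedPartner-other (top i) top≢bot top≢bot (top-≢ a) (top-≢ b) with partnerView (partner d (top i))
      ...     | isolated e = trans (out-top-bot i i (capCup-top-outer i a b o)) (trans (from2-isolated fuel′ i (trans (rest-agrees (top i) top≢bot top≢bot) e)) (sym (cong Merged.redirect e)))
      ...     | toBot j e = trans (out-top-bot i i (capCup-top-outer i a b o)) (trans (from2-bot fuel′ i j (trans (rest-agrees (top i) top≢bot top≢bot) e))
                           (sym (trans (cong Merged.redirect e) (Merged.redirect-other (bot j) bot≢top bot≢top))))
      ...     | toTop i′ e with column i′
      ...       | atP r = trans (out-top-bot i i (capCup-top-outer i a b o)) (trans (from2-top fuel′ i i′ (trans (rest-agrees (top i) top≢bot top≢bot) e))
                           (trans (from1-bot (k + k) i′ q (capCup-to-p r)) (trans (cong (λ z → from2 z q) fuel≡)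
                             (trans (walk-from-q (x≢q-via (top i) (to-p (top i) e r) (top-≢ b)) spare) (sym (redirect-to-y (top i) e r))))))
      ...       | atQ r = trans (out-top-bot i i (capCup-top-outer i a b o)) (trans (from2-top fuel′ i i′ (trans (rest-agrees (top i) top≢bot top≢bot) e))
                           (trans (from1-bot (k + k) i′ p (capCup-to-q r)) (trans (cong (λ z → from2 z p) fuel≡)
                             (trans (walk-from-p (y≢p-via (top i) (to-q (top i) e r) (top-≢ a)) spare) (sym (redirect-to-x (top i) e r))))))
      ...       | inner a′ b′ = ⊥-elim (none-to-inner-top (top i) i′ a′ b′ e)
      ...       | outer a′ b′ o′ = trans (out-top-bot i i (capCup-top-outer i a b o)) (trans (from2-top fuel′ i i′ (trans (rest-agrees (top i) top≢bot top≢bot) e))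
                           (trans (from1-top (k + k) i′ i′ (capCup-bot-outer i′ a′ b′ o′)) (sym (trans (cong Merged.redirect e) (Merged.redirect-other (top i′) (top-≢ a′) (top-≢ b′))))))

  module Slant (S : Fin k → Bool) (s t : Fin k) (s≢t : s ≢ t)
    (adjacent-above : ∀ j → j ≢ s → j ≢ t → (toℕ s <ᵇ toℕ j) ≡ (toℕ t <ᵇ toℕ j))
    (adjacent-below : ∀ j → j ≢ s → j ≢ t → (toℕ j <ᵇ toℕ s) ≡ (toℕ j <ᵇ toℕ t)) where

    slantTop slantBot : Fin k → Maybe (Vertex k)
    slantTop i = if eqF i s then just (bot t) else if eqF i t then nothing else partialIdTop S i
    slantBot j = if eqF j t then just (top s) else if eqF j s then nothing else partialIdBot S j

    slant : Raw k
    slant = rawByRow slantTop slantBot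

    slant-top-s : partner slant (top s) ≡ just (bot t)
    slant-top-s rewrite partner-rawByRow-top slantTop slantBot s | eqF-refl s = refl

    slant-top-t : partner slant (top t) ≡ nothing
    slant-top-t rewrite partner-rawByRow-top slantTop slantBot t | eqF-≢ (≢-sym s≢t) | eqF-refl t = refl

    slant-top-other : ∀ i → i ≢ s → i ≢ t → partner slant (top i) ≡ partialIdTop S i
    slant-top-other i i≢s i≢t rewrite partner-rawByRow-top slantTop slantBot i | eqF-≢ i≢s | eqF-≢ i≢t = refl

    slant-bot-t : partner slant (bot t) ≡ just (top s)
    slant-bot-t rewrite partner-rawByRow-bot slantTop slantBot t | eqF-refl t = refl

    slant-bot-s : partner slant (bot s) ≡ nothing
    slant-bot-s rewrite partner-rawByRow-bot slantTop slantBot s | eqF-≢ s≢t | eqF-refl s = refl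

    slant-bot-other : ∀ j → j ≢ s → j ≢ t → partner slant (bot j) ≡ partialIdBot S j
    slant-bot-other j j≢s j≢t rewrite partner-rawByRow-bot slantTop slantBot j | eqF-≢ j≢t | eqF-≢ j≢s = refl

    data SlantEdge (a b : Vertex k) : Set where
      isSlant    : SameChord a b (top s) (bot t) → SlantEdge a b
      isVertical : ∀ j → j ≢ s → j ≢ t → S j ≡ true → Vertical j a b → SlantEdge a b

    slant-edge : ∀ a b → partner slant a ≡ just b → SlantEdge a b
    slant-edge a b e with view {k} a
    ... | vtop i with i Fin.≟ s
    ...   | yes refl = isSlant (inj₁ (refl , just-injective (trans (sym e) slant-top-s)))
    ...   | no i≢s with i Fin.≟ t
    ...     | yes refl = ⊥-elim (nothing≢just (trans (sym slant-top-t) e))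
    ...     | no i≢t with S i in si
    ...       | true  = isVertical i i≢s i≢t si (inj₁ (refl , just-injective (trans (sym e) (trans (slant-top-other i i≢s i≢t) (cong (λ b → if b then _ else _) si)))))
    ...       | false = ⊥-elim (nothing≢just (trans (sym (trans (slant-top-other i i≢s i≢t) (cong (λ b → if b then _ else _) si))) e))
    slant-edge a b e | vbot j with j Fin.≟ t
    ...   | yes refl = isSlant (inj₂ (refl , just-injective (trans (sym e) slant-bot-t)))
    ...   | no j≢t with j Fin.≟ s
    ...     | yes refl = ⊥-elim (nothing≢just (trans (sym slant-bot-s) e))
    ...     | no j≢s with S j in sj
    ...       | true  = isVertical j j≢s j≢t sj (inj₂ (refl , just-injective (trans (sym e) (trans (slant-bot-other j j≢s j≢t) (cong (λ b → if b then _ else _) sj)))))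
    ...       | false = ⊥-elim (nothing≢just (trans (sym (trans (slant-bot-other j j≢s j≢t) (cong (λ b → if b then _ else _) sj))) e))

    slant-involution : Involution slant
    slant-involution a b e with slant-edge a b e
    ... | isSlant (inj₁ (refl , refl)) = top≢bot , slant-bot-t
    ... | isSlant (inj₂ (refl , refl)) = bot≢top , slant-top-s
    ... | isVertical j j≢s j≢t sj (inj₁ (refl , refl)) = top≢bot , trans (slant-bot-other j j≢s j≢t) (cong (λ b → if b then _ else _) sj)
    ... | isVertical j j≢s j≢t sj (inj₂ (refl , refl)) = bot≢top , trans (slant-top-other j j≢s j≢t) (cong (λ b → if b then _ else _) sj)

    slant-nonCrossing : NonCrossing slant
    slant-nonCrossing = NonCrossing-intro slant slant-involution separates-not
      where
      separates-not : ∀ a b c f → partner slant a ≡ just b → partner slant c ≡ just f → c ≢ a → c ≢ b →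
                      insideChord a b c ≡ insideChord a b f
      separates-not a b c f ea ec c≢a c≢b with slant-edge a b ea | slant-edge c f ec
      ... | isSlant o | isSlant o′ = ⊥-elim (SameChord-unique o o′ c≢a c≢b)
      ... | isSlant o | isVertical j j≢s j≢t _ v = insideChord-chords o v
              (trans (insideChord-through-top s t j) (trans (adjacent-above j j≢s j≢t) (sym (insideChord-through-bot s t j))))
      ... | isVertical i i≢s i≢t _ v | isSlant o′ = insideChord-chords v o′
              (trans (insideChord-through-top i i s) (trans (adjacent-below i i≢s i≢t) (sym (insideChord-through-bot i i t))))
      ... | isVertical _ _ _ _ v | isVertical _ _ _ _ w = vertical-separates-not v w

    slant-isMotzkin : T (isMotzkin slant)
    slant-isMotzkin = isMotzkin-intro slant slant-involution slant-nonCrossing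

  module Shift (S : Fin k → Bool) (s t : Fin k) (s≢t : s ≢ t)
    (adjacent-above : ∀ j → j ≢ s → j ≢ t → (toℕ s <ᵇ toℕ j) ≡ (toℕ t <ᵇ toℕ j))
    (adjacent-below : ∀ j → j ≢ s → j ≢ t → (toℕ j <ᵇ toℕ s) ≡ (toℕ j <ᵇ toℕ t)) where

    module A = Slant S s t s≢t adjacent-above adjacent-below
    module B = Slant S t s (≢-sym s≢t) (λ j j≢t j≢s → sym (adjacent-above j j≢s j≢t))
                                       (λ j j≢t j≢s → sym (adjacent-below j j≢s j≢t))

    moved : Fin k → Bool
    moved j = if eqF j s then true else if eqF j t then false else S j

    moved-s : moved s ≡ true
    moved-s rewrite eqF-refl s = refl

    moved-t : moved t ≡ false
    moved-t rewrite eqF-≢ (≢-sym s≢t) | eqF-refl t = refl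

    moved-other : ∀ j → j ≢ s → j ≢ t → moved j ≡ S j
    moved-other j j≢s j≢t rewrite eqF-≢ j≢s | eqF-≢ j≢t = refl

    noMiddleLoop-slants : Walk.NoMiddleLoop A.slant B.slant
    noMiddleLoop-slants j j′ j″ e₁ e₂ with A.slant-edge (bot j) (bot j′) e₁
    ... | A.isSlant (inj₁ (r , _)) = bot≢top r
    ... | A.isSlant (inj₂ (_ , r)) = bot≢top r
    ... | A.isVertical _ _ _ _ (inj₁ (r , _)) = bot≢top r
    ... | A.isVertical _ _ _ _ (inj₂ (_ , r)) = bot≢top r

    compose-slants : compose A.slant B.slant ≡ partialId moved
    compose-slants = raw-tabulate-partner (partialId moved) same
      where
      open Walk A.slant B.slant
      same : ∀ v → outPartner v ≡ partner (partialId moved) v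
      same v with view {k} v
      ... | vtop i with i Fin.≟ s
      ...   | yes refl = trans (out-top-bot s t A.slant-top-s) (trans (from2-bot fuel′ t s B.slant-top-s) (sym (partialId-top-in moved s moved-s)))
      ...   | no i≢s with i Fin.≟ t
      ...     | yes refl = trans (out-top-isolated t A.slant-top-t) (sym (partialId-top-out moved t moved-t))
      ...     | no i≢t with S i in si
      ...       | true  = trans (out-top-bot i i (trans (A.slant-top-other i i≢s i≢t) (cong (λ b → if b then _ else _) si)))
                            (trans (from2-bot fuel′ i i (trans (B.slant-top-other i i≢t i≢s) (cong (λ b → if b then _ else _) si)))
                                   (sym (partialId-top-in moved i (trans (moved-other i i≢s i≢t) si))))
      ...       | false = trans (out-top-isolated i (trans (A.slant-top-other i i≢s i≢t) (cong (λ b → if b then _ else _) si)))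
                            (sym (partialId-top-out moved i (trans (moved-other i i≢s i≢t) si)))
      same v | vbot u with u Fin.≟ s
      ...   | yes refl = trans (out-bot-top s t B.slant-bot-t) (trans (from1-top fuel′ t s A.slant-bot-t) (sym (partialId-bot-in moved s moved-s)))
      ...   | no u≢s with u Fin.≟ t
      ...     | yes refl = trans (out-bot-isolated t B.slant-bot-s) (sym (partialId-bot-out moved t moved-t))
      ...     | no u≢t with S u in su
      ...       | true  = trans (out-bot-top u u (trans (B.slant-bot-other u u≢t u≢s) (cong (λ b → if b then _ else _) su)))
                            (trans (from1-top fuel′ u u (trans (A.slant-bot-other u u≢s u≢t) (cong (λ b → if b then _ else _) su)))
                                   (sym (partialId-bot-in moved u (trans (moved-other u u≢s u≢t) su))))
      ...       | false = trans (out-bot-isolated u (trans (B.slant-bot-other u u≢t u≢s) (cong (λ b → if b then _ else _) su)))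
                            (sym (partialId-bot-out moved u (trans (moved-other u u≢s u≢t) su)))

  partialId-threshold : ∀ S m → IsThreshold S m → partialId S ≡ oneRaw m k
  partialId-threshold S m thr = raw-ext same
    where
    same : ∀ v → partner (partialId S) v ≡ partner (oneRaw m k) v
    same v with view {k} v
    ... | vtop i = trans (partner-rawByRow-top (partialIdTop S) (partialIdBot S) i)
                         (trans (cong (λ b → if b then just (bot i) else nothing) (thr i)) (sym (partner-oneRaw-top m k i)))
    ... | vbot j = trans (partner-rawByRow-bot (partialIdTop S) (partialIdBot S) j)
                         (trans (cong (λ b → if b then just (top j) else nothing) (thr j)) (sym (partner-oneRaw-bot m k j)))

  record InnermostCap (d : Raw k) : Set where
    field
      p q          : Fin k
      p<q          : toℕ p < toℕ q
      capped       : partner d (top p) ≡ just (top q)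
      empty-inside : ∀ (j : Fin k) → toℕ p < toℕ j → toℕ j < toℕ q → partner d (top j) ≡ nothing

  record InnermostCup (d : Raw k) : Set where
    field
      p q          : Fin k
      p<q          : toℕ p < toℕ q
      cupped       : partner d (bot p) ≡ just (bot q)
      empty-inside : ∀ (j : Fin k) → toℕ p < toℕ j → toℕ j < toℕ q → partner d (bot j) ≡ nothing

  module Shape (d : Raw k) (valid : T (isMotzkin d)) where

    inv : Involution d
    inv = isMotzkin⇒Involution d valid

    nc : NonCrossing d
    nc = isMotzkin⇒NonCrossing d valid

    is-just-false : ∀ {m : Maybe (Vertex k)} → is-just m ≡ false → m ≡ nothing
    is-just-false {nothing} _ = refl

    -- A vertex strictly under the cap p–q is joined to a top vertex under it (it cannot escape the cap), so
    -- either nothing is under the cap or there is a strictly narrower cap.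
    narrow-cap : ∀ n (p q : Fin k) → toℕ q ∸ toℕ p < n → toℕ p < toℕ q → partner d (top p) ≡ just (top q) → InnermostCap d
    narrow-cap (suc n) p q width<n p<q capped with searchFin (λ j → Span.strictlyBetween p q p<q j ∧ is-just (partner d (top j)))
    ... | inj₂ none = record { p = p ; q = q ; p<q = p<q ; capped = capped ; empty-inside = empty }
      where
      empty : ∀ (j : Fin k) → toℕ p < toℕ j → toℕ j < toℕ q → partner d (top j) ≡ nothing
      empty j p<j j<q = is-just-false (subst (λ b → b ∧ is-just (partner d (top j)) ≡ false)
                                             (Span.strictlyBetween-inner p q p<q j p<j j<q) (none j))
    ... | inj₁ (j , found) with ∧-split found
    ...   | inside , has-edge with ∧-split inside
    ...     | p<ᵇj , j<ᵇq with strictly-between-≢ {p = p} {q} p<ᵇj j<ᵇq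
    ...       | j≢p , j≢q with partnerView {k} (partner d (top j))
    ...         | isolated e = ⊥-elim (true≢false (trans (sym has-edge) (cong is-just e)))
    ...         | toBot u e = ⊥-elim (true≢false (trans (sym (trans (insideChord-cap-top p q j p<q) inside))
                                (trans (NonCrossing⇒insideChord d inv nc (top p) (top q) (top j) (bot u) capped e (top-≢ j≢p) (top-≢ j≢q))
                                       (insideChord-cap-bot p q u p<q))))
    ...         | toTop j′ e with ∧-split (trans (sym (insideChord-cap-top p q j′ p<q))
                                    (trans (sym (NonCrossing⇒insideChord d inv nc (top p) (top q) (top j) (top j′) capped e (top-≢ j≢p) (top-≢ j≢q)))
                                           (trans (insideChord-cap-top p q j p<q) inside)))
    ...           | p<ᵇj′ , j′<ᵇq with <-cmp (toℕ j) (toℕ j′)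
    ...             | tri< j<j′ _ _ = narrow-cap n j j′
                        (<-≤-trans (width-shrinks (toℕ p) (toℕ j) (toℕ q) (toℕ j′) (≡true⇒< p<ᵇj) (≡true⇒< j′<ᵇq) p<q) (≤-pred width<n)) j<j′ e
    ...             | tri≈ _ j≡j′ _ = ⊥-elim (proj₁ (inv (top j) (top j′) e) (cong top (toℕ-injective j≡j′)))
    ...             | tri> _ _ j′<j = narrow-cap n j′ j
                        (<-≤-trans (width-shrinks (toℕ p) (toℕ j′) (toℕ q) (toℕ j) (≡true⇒< p<ᵇj′) (≡true⇒< j<ᵇq) p<q) (≤-pred width<n)) j′<j
                        (proj₂ (inv (top j) (top j′) e))

    narrow-cup : ∀ n (p q : Fin k) → toℕ q ∸ toℕ p < n → toℕ p < toℕ q → partner d (bot p) ≡ just (bot q) → InnermostCup d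
    narrow-cup (suc n) p q width<n p<q cupped with searchFin (λ j → Span.strictlyBetween p q p<q j ∧ is-just (partner d (bot j)))
    ... | inj₂ none = record { p = p ; q = q ; p<q = p<q ; cupped = cupped ; empty-inside = empty }
      where
      empty : ∀ (j : Fin k) → toℕ p < toℕ j → toℕ j < toℕ q → partner d (bot j) ≡ nothing
      empty j p<j j<q = is-just-false (subst (λ b → b ∧ is-just (partner d (bot j)) ≡ false)
                                             (Span.strictlyBetween-inner p q p<q j p<j j<q) (none j))
    ... | inj₁ (j , found) with ∧-split found
    ...   | inside , has-edge with ∧-split inside
    ...     | p<ᵇj , j<ᵇq with strictly-between-≢ {p = p} {q} p<ᵇj j<ᵇq
    ...       | j≢p , j≢q with partnerView {k} (partner d (bot j))
    ...         | isolated e = ⊥-elim (true≢false (trans (sym has-edge) (cong is-just e)))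
    ...         | toTop u e = ⊥-elim (true≢false (trans (sym (trans (insideChord-cup-bot p q j p<q) (cong₂ _∧_ j<ᵇq p<ᵇj)))
                                (trans (NonCrossing⇒insideChord d inv nc (bot p) (bot q) (bot j) (top u) cupped e (bot-≢ j≢p) (bot-≢ j≢q))
                                       (insideChord-cup-top p q u p<q))))
    ...         | toBot j′ e with ∧-split (trans (sym (insideChord-cup-bot p q j′ p<q))
                                    (trans (sym (NonCrossing⇒insideChord d inv nc (bot p) (bot q) (bot j) (bot j′) cupped e (bot-≢ j≢p) (bot-≢ j≢q)))
                                           (trans (insideChord-cup-bot p q j p<q) (cong₂ _∧_ j<ᵇq p<ᵇj))))
    ...           | j′<ᵇq , p<ᵇj′ with <-cmp (toℕ j) (toℕ j′)
    ...             | tri< j<j′ _ _ = narrow-cup n j j′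
                        (<-≤-trans (width-shrinks (toℕ p) (toℕ j) (toℕ q) (toℕ j′) (≡true⇒< p<ᵇj) (≡true⇒< j′<ᵇq) p<q) (≤-pred width<n)) j<j′ e
    ...             | tri≈ _ j≡j′ _ = ⊥-elim (proj₁ (inv (bot j) (bot j′) e) (cong bot (toℕ-injective j≡j′)))
    ...             | tri> _ _ j′<j = narrow-cup n j′ j
                        (<-≤-trans (width-shrinks (toℕ p) (toℕ j′) (toℕ q) (toℕ j) (≡true⇒< p<ᵇj′) (≡true⇒< j<ᵇq) p<q) (≤-pred width<n)) j′<j
                        (proj₂ (inv (bot j) (bot j′) e))

    innermost-cap : ∀ (i j : Fin k) → partner d (top i) ≡ just (top j) → InnermostCap d
    innermost-cap i j e with <-cmp (toℕ i) (toℕ j)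
    ... | tri< i<j _ _ = narrow-cap (suc (toℕ j ∸ toℕ i)) i j (n<1+n _) i<j e
    ... | tri≈ _ i≡j _ = ⊥-elim (proj₁ (inv (top i) (top j) e) (cong top (toℕ-injective i≡j)))
    ... | tri> _ _ j<i = narrow-cap (suc (toℕ i ∸ toℕ j)) j i (n<1+n _) j<i (proj₂ (inv (top i) (top j) e))

    innermost-cup : ∀ (i j : Fin k) → partner d (bot i) ≡ just (bot j) → InnermostCup d
    innermost-cup i j e with <-cmp (toℕ i) (toℕ j)
    ... | tri< i<j _ _ = narrow-cup (suc (toℕ j ∸ toℕ i)) i j (n<1+n _) i<j e
    ... | tri≈ _ i≡j _ = ⊥-elim (proj₁ (inv (bot i) (bot j) e) (cong bot (toℕ-injective i≡j)))
    ... | tri> _ _ j<i = narrow-cup (suc (toℕ i ∸ toℕ j)) j i (n<1+n _) j<i (proj₂ (inv (bot i) (bot j) e))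

    module Rook (stable₁ : ∀ (c : Fin k) → partner d (top c) ≡ nothing → partner d (bot c) ≡ nothing)
                (stable₂ : ∀ (c : Fin k) → partner d (bot c) ≡ nothing → partner d (top c) ≡ nothing)
                (no-cap : ∀ (i j : Fin k) → partner d (top i) ≢ just (top j))
                (no-cup : ∀ (i j : Fin k) → partner d (bot i) ≢ just (bot j)) where

      top-to-bot : ∀ (c : Fin k) → partner d (top c) ≢ nothing → ∃ λ u → partner d (top c) ≡ just (bot u)
      top-to-bot c c-used with partnerView {k} (partner d (top c))
      ... | isolated e = ⊥-elim (c-used e)
      ... | toTop i e  = ⊥-elim (no-cap c i e)
      ... | toBot u e  = u , e

      bot-to-top : ∀ (c : Fin k) → partner d (bot c) ≢ nothing → ∃ λ t → partner d (bot c) ≡ just (top t)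
      bot-to-top c c-used with partnerView {k} (partner d (bot c))
      ... | isolated e = ⊥-elim (c-used e)
      ... | toTop t e  = t , e
      ... | toBot u e  = ⊥-elim (no-cup c u e)

      -- By induction on j: a strand top j – bot u with u < j would steal bot u from the (vertical) strand at u,
      -- and one with u > j would cross the strand ending at bot j.
      vertical-below : ∀ n (j : Fin k) → toℕ j < n → ∀ u → partner d (top j) ≡ just (bot u) → u ≡ j
      vertical-below (suc n) j j<n u e with <-cmp (toℕ u) (toℕ j)
      ... | tri≈ _ u≡j _ = toℕ-injective u≡j
      ... | tri< u<j _ _ = ⊥-elim (toℕ-<⇒≢ u<j (top-injective {k} (just-injective (trans (sym bot-u-to-top-u) (proj₂ (inv (top j) (bot u) e))))))
        where
        top-u-used : partner d (top u) ≢ nothing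
        top-u-used isolated-u = nothing≢just (trans (sym (stable₁ u isolated-u)) (proj₂ (inv (top j) (bot u) e)))
        bot-u-to-top-u : partner d (bot u) ≡ just (top u)
        bot-u-to-top-u with top-to-bot u top-u-used
        ... | u′ , e′ with vertical-below n u (<-≤-trans u<j (≤-pred j<n)) u′ e′
        ...   | refl = proj₂ (inv (top u) (bot u) e′)
      ... | tri> _ _ j<u with bot-to-top j (λ isolated-j → nothing≢just (trans (sym (stable₂ j isolated-j)) e))
      ...   | t , et with <-cmp (toℕ t) (toℕ j)
      ...     | tri≈ _ t≡j _ = ⊥-elim (≢-sym (toℕ-<⇒≢ j<u) (bot-injective {k} (just-injective
                                 (trans (sym e) (subst (λ z → partner d (top z) ≡ just (bot j)) (toℕ-injective t≡j) (proj₂ (inv (bot j) (top t) et)))))))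
      ...     | tri< t<j _ _ = ⊥-elim (toℕ-<⇒≢ t<j (sym (vertical-below n t (<-≤-trans t<j (≤-pred j<n)) j (proj₂ (inv (bot j) (top t) et)))))
      ...     | tri> _ _ j<t = ⊥-elim (true≢false (trans (sym (trans (insideChord-through-top j u t) (<ᵇ-true j<t)))
                                 (trans (NonCrossing⇒insideChord d inv nc (top j) (bot u) (top t) (bot j) e (proj₂ (inv (bot j) (top t) et))
                                                                  (top-≢ (≢-sym (toℕ-<⇒≢ j<t))) top≢bot)
                                        (trans (insideChord-through-bot j u j) (<ᵇ-false (<⇒≤ j<u))))))

      vertical : ∀ (j u : Fin k) → partner d (top j) ≡ just (bot u) → u ≡ j
      vertical j = vertical-below (suc (toℕ j)) j (n<1+n _)

      support : Fin k → Bool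
      support j = is-just (partner d (top j))

      rook-partialId : d ≡ partialId support
      rook-partialId = sym (raw-ext same)
        where
        same : ∀ v → partner (partialId support) v ≡ partner d v
        same v with view {k} v
        ... | vtop j rewrite partner-rawByRow-top (partialIdTop support) (partialIdBot support) j with partnerView {k} (partner d (top j))
        ...   | isolated e rewrite e = refl
        ...   | toTop i e = ⊥-elim (no-cap j i e)
        ...   | toBot u e rewrite e | vertical j u e = refl
        same v | vbot j rewrite partner-rawByRow-bot (partialIdTop support) (partialIdBot support) j with partnerView {k} (partner d (bot j))
        ...   | isolated e rewrite e | stable₂ j e = refl
        ...   | toBot u e = ⊥-elim (no-cup j u e)
        ...   | toTop t e with vertical t j (proj₂ (inv (bot j) (top t) e))
        ...     | refl rewrite e | proj₂ (inv (bot j) (top j) e) = refl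

  Balanced : Raw k → Set
  Balanced d = ∀ (c : Fin k) → partner d (top c) ≡ nothing → partner d (bot c) ≡ nothing

  Balanced′ : Raw k → Set
  Balanced′ d = ∀ (c : Fin k) → partner d (bot c) ≡ nothing → partner d (top c) ≡ nothing

  data Case (d : Raw k) : Set where
    top-isolated : ∀ (c : Fin k) (w : Vertex k) → partner d (top c) ≡ nothing → partner d (bot c) ≡ just w → Case d
    bot-isolated : ∀ (c : Fin k) (w : Vertex k) → partner d (bot c) ≡ nothing → partner d (top c) ≡ just w → Case d
    with-cap     : Balanced d → Balanced′ d → ∀ (i j : Fin k) → partner d (top i) ≡ just (top j) → Case d
    with-cup     : Balanced d → Balanced′ d → ∀ (i j : Fin k) → partner d (bot i) ≡ just (bot j) → Case d
    rook         : Balanced d → Balanced′ d → (∀ (i j : Fin k) → partner d (top i) ≢ just (top j)) →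
                   (∀ (i j : Fin k) → partner d (bot i) ≢ just (bot j)) → Case d

  isTopVertex : Vertex k → Bool
  isTopVertex = byRow {k} {Bool} (λ _ → true) (λ _ → false)

  isTopVertex-top : ∀ (i : Fin k) → isTopVertex (top i) ≡ true
  isTopVertex-top = byRow-top {k} {Bool} (λ _ → true) (λ _ → false)

  isTopVertex-bot : ∀ (j : Fin k) → isTopVertex (bot j) ≡ false
  isTopVertex-bot = byRow-bot {k} {Bool} (λ _ → true) (λ _ → false)

  toTopᵇ toBotᵇ : Maybe (Vertex k) → Bool
  toTopᵇ nothing  = false
  toTopᵇ (just w) = isTopVertex w
  toBotᵇ nothing  = false
  toBotᵇ (just w) = not (isTopVertex w)

  balanced-intro : ∀ (d : Raw k) → (∀ (c : Fin k) → not (is-just (partner d (top c))) ∧ is-just (partner d (bot c)) ≡ false) → Balanced d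
  balanced-intro d none c e with partner d (top c) | partner d (bot c) | none c
  ... | nothing | nothing | _  = refl
  ... | nothing | just _  | ()

  balanced′-intro : ∀ (d : Raw k) → (∀ (c : Fin k) → is-just (partner d (top c)) ∧ not (is-just (partner d (bot c))) ≡ false) → Balanced′ d
  balanced′-intro d none c e with partner d (top c) | partner d (bot c) | none c
  ... | nothing | nothing | _  = refl
  ... | just _  | nothing | ()

  top-isolated-witness : ∀ (d : Raw k) (c : Fin k) → not (is-just (partner d (top c))) ∧ is-just (partner d (bot c)) ≡ true →
                         partner d (top c) ≡ nothing × ∃ λ w → partner d (bot c) ≡ just w
  top-isolated-witness d c found with partner d (top c) | partner d (bot c) | found
  ... | nothing | just w | _ = refl , w , refl

  bot-isolated-witness : ∀ (d : Raw k) (c : Fin k) → is-just (partner d (top c)) ∧ not (is-just (partner d (bot c))) ≡ true →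
                         partner d (bot c) ≡ nothing × ∃ λ w → partner d (top c) ≡ just w
  bot-isolated-witness d c found with partner d (top c) | partner d (bot c) | found
  ... | just w | nothing | _ = refl , w , refl

  classify : ∀ (d : Raw k) → Case d
  classify d with searchFin (λ c → not (is-just (partner d (top c))) ∧ is-just (partner d (bot c)))
  ... | inj₁ (c , found) = let (et , w , eb) = top-isolated-witness d c found in top-isolated c w et eb
  ... | inj₂ none with searchFin (λ c → is-just (partner d (top c)) ∧ not (is-just (partner d (bot c))))
  ...   | inj₁ (c , found) = let (eb , w , et) = bot-isolated-witness d c found in bot-isolated c w eb et
  classify d | inj₂ none | inj₂ none′ with searchFin (λ c → toTopᵇ (partner d (top c)))
  ...     | inj₁ (c , found) with partnerView {k} (partner d (top c))
  ...       | toTop j e  = with-cap (balanced-intro d none) (balanced′-intro d none′) c j e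
  ...       | isolated e = ⊥-elim (true≢false (trans (sym found) (cong toTopᵇ e)))
  ...       | toBot u e  = ⊥-elim (true≢false (trans (sym found) (trans (cong toTopᵇ e) (isTopVertex-bot u))))
  classify d | inj₂ none | inj₂ none′ | inj₂ no-cap with searchFin (λ c → toBotᵇ (partner d (bot c)))
  ...       | inj₁ (c , found) with partnerView {k} (partner d (bot c))
  ...         | toBot j e  = with-cup (balanced-intro d none) (balanced′-intro d none′) c j e
  ...         | isolated e = ⊥-elim (true≢false (trans (sym found) (cong toBotᵇ e)))
  ...         | toTop t e  = ⊥-elim (true≢false (trans (sym found) (trans (cong toBotᵇ e) (cong not (isTopVertex-top t)))))
  classify d | inj₂ none | inj₂ none′ | inj₂ no-cap | inj₂ no-cup =
    rook (balanced-intro d none) (balanced′-intro d none′)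
         (λ i j e → true≢false (trans (sym (isTopVertex-top j)) (trans (sym (cong toTopᵇ e)) (no-cap i))))
         (λ i j e → true≢false (trans (sym (cong not (isTopVertex-bot j))) (trans (sym (cong toBotᵇ e)) (no-cup i))))

  module TraceInduction {c r : Level} (K : CommutativeRing c r) (x : CommutativeRing.Carrier K)
    {n m : ℕ} (ρ : Diagram k → Matrices.Mat K n) (σ : Diagram k → Matrices.Mat K m)
    (ρ-rep : Matrices.IsRep K x k n ρ) (σ-rep : Matrices.IsRep K x k m σ)
    (agree-on-ones : ∀ (ℓ : ℕ) → ℓ ≤ k → ∀ (d : Diagram k) → edges d ≡ oneRaw ℓ k →
                     CommutativeRing._≈_ K (Matrices.trace K (ρ d)) (Matrices.trace K (σ d))) where

    open CommutativeRing K using (_≈_; _*_; *-cong; setoid) renaming (refl to ≈-refl)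
    open Matrices K using (trace; pow)
    open Traces K using (trace-rotate)
    open import Relation.Binary.Reasoning.Setoid setoid

    Agree : Diagram k → Set r
    Agree D = trace (ρ D) ≈ trace (σ D)

    agree-rotate : (A B D D′ : Diagram k) → edges D ≡ compose (edges A) (edges B) → loopCount (edges A) (edges B) ≡ 0 →
                   edges D′ ≡ compose (edges B) (edges A) → Agree D′ → Agree D
    agree-rotate A B D D′ AB≡D no-loop BA≡D′ agree′ = begin
      trace (ρ D)                                          ≈⟨ trace-rotate ρ-rep A B D D′ AB≡D no-loop BA≡D′ ⟩
      pow x (loopCount (edges B) (edges A)) * trace (ρ D′) ≈⟨ *-cong ≈-refl agree′ ⟩
      pow x (loopCount (edges B) (edges A)) * trace (σ D′) ≈⟨ trace-rotate σ-rep A B D D′ AB≡D no-loop BA≡D′ ⟨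
      trace (σ D)                                          ∎

    -- Conjugating by two slants moves a gap of S one step up; the weight of S drops until S is a threshold.
    agree-partialId : ∀ N S → weight S < N → ∀ (D : Diagram k) → edges D ≡ partialId S → Agree D
    agree-partialId (suc N) S weight<N D D≡S with threshold-or-gap S
    ... | inj₁ (ℓ , ℓ≤k , thr) = agree-on-ones ℓ ℓ≤k D (trans D≡S (partialId-threshold S ℓ thr))
    ... | inj₂ (a , b , b≡a+1 , sa , sb) =
      agree-rotate (diagram U.A.slant U.A.slant-isMotzkin) (diagram U.B.slant U.B.slant-isMotzkin) D
                   (diagram (partialId V.moved) (partialId-isMotzkin V.moved))
                   (trans D≡S (trans (partialId-cong S≗U) (sym U.compose-slants)))
                   (Walk.loops-none U.A.slant U.B.slant U.noMiddleLoop-slants)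
                   (sym V.compose-slants)
                   (agree-partialId N V.moved
                      (<-≤-trans (weight-shift S V.moved a b b≡a+1 sa sb V.moved-s V.moved-t V.moved-other) (≤-pred weight<N)) _ refl)
      where
      b≢a : b ≢ a
      b≢a b≡a = <-irrefl (trans (sym (cong toℕ b≡a)) b≡a+1) (n<1+n (toℕ a))
      module U = Shift S b a b≢a (λ j j≢b j≢a → successor-above a b j b≡a+1 j≢b j≢a)
                                 (λ j j≢b j≢a → successor-below a b j b≡a+1 j≢b j≢a)
      module V = Shift S a b (≢-sym b≢a) (λ j j≢a j≢b → sym (successor-above a b j b≡a+1 j≢b j≢a))
                                         (λ j j≢a j≢b → sym (successor-below a b j b≡a+1 j≢b j≢a))
      S≗U : ∀ j → S j ≡ U.moved j
      S≗U j with j Fin.≟ b | j Fin.≟ a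
      ... | yes refl | _        = sb
      ... | no _     | yes refl = sa
      ... | no _     | no _     = refl

    Below : ℕ → Set r
    Below N = ∀ (D : Diagram k) → size (edges D) < N → Agree D

    agree-with-cap : ∀ {N} → Below N → ∀ d (valid : T (isMotzkin d)) → size d < suc N →
                     Balanced d → Balanced′ d → InnermostCap d → Agree (diagram d valid)
    agree-with-cap ih d valid size<N balanced balanced′ record { p = p ; q = q ; p<q = p<q ; capped = capped ; empty-inside = empty }
      with partner d (bot p) in ex | partner d (bot q) in ey
    ... | nothing | _       = ⊥-elim (nothing≢just (trans (sym (balanced′ p ex)) capped))
    ... | just _  | nothing = ⊥-elim (nothing≢just (trans (sym (balanced′ q ey)) (proj₂ (isMotzkin⇒Involution d valid _ _ capped))))
    ... | just x′ | just y′ =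
      agree-rotate (diagram Cap.capCup Cap.capCup-isMotzkin) (diagram Cap.rest (dropEdge-isMotzkin d _ valid)) (diagram d valid)
                   (diagram Cap.Merged.merged Cap.Merged.merged-isMotzkin)
                   (sym Cap.factor) (Walk.loops-none Cap.capCup Cap.rest Cap.noMiddleLoop) (sym Cap.swapped)
                   (ih _ (<-≤-trans Cap.Merged.size-merged (≤-pred size<N)))
      where
      module Cap = CapFactorisation d valid p q p<q capped empty (λ j p<j j<q → balanced j (empty j p<j j<q)) x′ y′ ex ey

    agree-with-cup : ∀ {N} → Below N → ∀ d (valid : T (isMotzkin d)) → size d < suc N →
                     Balanced d → Balanced′ d → InnermostCup d → Agree (diagram d valid)
    agree-with-cup ih d valid size<N balanced balanced′ record { p = p ; q = q ; p<q = p<q ; cupped = cupped ; empty-inside = empty }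
      with partner d (top p) in ex | partner d (top q) in ey
    ... | nothing | _       = ⊥-elim (nothing≢just (trans (sym (balanced p ex)) cupped))
    ... | just _  | nothing = ⊥-elim (nothing≢just (trans (sym (balanced q ey)) (proj₂ (isMotzkin⇒Involution d valid _ _ cupped))))
    ... | just x′ | just y′ =
      agree-rotate (diagram Cup.rest (dropEdge-isMotzkin d _ valid)) (diagram Cup.capCup Cup.capCup-isMotzkin) (diagram d valid)
                   (diagram Cup.Merged.merged Cup.Merged.merged-isMotzkin)
                   (sym Cup.factor) (Walk.loops-none Cup.rest Cup.capCup Cup.noMiddleLoop) (sym Cup.swapped)
                   (ih _ (<-≤-trans Cup.Merged.size-merged (≤-pred size<N)))
      where
      module Cup = CupFactorisation d valid p q p<q cupped (λ j p<j j<q → balanced′ j (empty j p<j j<q)) empty x′ y′ ex ey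

    agree-size : ∀ N → Below N
    agree-size (suc N) (diagram d valid) size<N with classify d
    ... | top-isolated c w top-c bot-c =
      agree-rotate (diagram (idExcept c) (partialId-isMotzkin (allBut c))) (diagram d valid) (diagram d valid) D′
                   (sym (trans (compose-idExcept-left c d) (dropEdge-isolated d (top c) (isMotzkin⇒Involution d valid) top-c)))
                   (Walk.loops-none (idExcept c) d (noMiddleLoop-idExcept-left c d))
                   (sym (compose-idExcept-right c d))
                   (agree-size N D′ (<-≤-trans (size-dropEdge d (bot c) w bot-c) (≤-pred size<N)))
      where
      D′ : Diagram k
      D′ = diagram (dropEdge d (bot c)) (dropEdge-isMotzkin d (bot c) valid)
    ... | bot-isolated c w bot-c top-c =
      agree-rotate (diagram d valid) (diagram (idExcept c) (partialId-isMotzkin (allBut c))) (diagram d valid) D′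
                   (sym (trans (compose-idExcept-right c d) (dropEdge-isolated d (bot c) (isMotzkin⇒Involution d valid) bot-c)))
                   (Walk.loops-none d (idExcept c) (noMiddleLoop-idExcept-right c d))
                   (sym (compose-idExcept-left c d))
                   (agree-size N D′ (<-≤-trans (size-dropEdge d (top c) w top-c) (≤-pred size<N)))
      where
      D′ : Diagram k
      D′ = diagram (dropEdge d (top c)) (dropEdge-isMotzkin d (top c) valid)
    ... | with-cap balanced balanced′ i j capped =
      agree-with-cap (agree-size N) d valid size<N balanced balanced′ (Shape.innermost-cap d valid i j capped)
    ... | with-cup balanced balanced′ i j cupped =
      agree-with-cup (agree-size N) d valid size<N balanced balanced′ (Shape.innermost-cup d valid i j cupped)
    ... | rook balanced balanced′ no-cap no-cup =
      agree-partialId (suc (weight R.support)) R.support (n<1+n _) (diagram d valid) R.rook-partialId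
      where
      module R = Shape.Rook d valid balanced balanced′ no-cap no-cup

mainTheorem8 : ∀ {c r : Level} (K : CommutativeRing c r) (x : CommutativeRing.Carrier K) (k : ℕ)
    {n m : ℕ} (ρ : Diagram k → Matrices.Mat K n) (σ : Diagram k → Matrices.Mat K m) →
    Matrices.IsRep K x k n ρ → Matrices.IsRep K x k m σ →
    (∀ (ℓ : ℕ) → ℓ ≤ k → ∀ (d : Diagram k) → edges d ≡ oneRaw ℓ k →
    CommutativeRing._≈_ K (Matrices.trace K (ρ d)) (Matrices.trace K (σ d))) →
    ∀ (d : Diagram k) →
    CommutativeRing._≈_ K (Matrices.trace K (ρ d)) (Matrices.trace K (σ d))
mainTheorem8 K x k ρ σ ρ-rep σ-rep agree-on-ones d =
  TraceInduction.agree-size K x ρ σ ρ-rep σ-rep agree-on-ones (suc (size (edges d))) d (n<1+n _)
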